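{- Let $v_1,\dots,v_{d+1}$ be the vertices of a $d$-simplex in $\mathbb{R}^d$ in general position. Let $1\le i\le d$, let $(\Gamma,\Delta)$ be a partition of $[d]$ with $|\Gamma|=i$, let $\gamma$ be an ordering $(\gamma(1),\dots,\gamma(i))$ of $\Gamma$ and $\delta$ an ordering $(\delta(1),\dots,\delta(d-i))$ of $\Delta$. Let $\tilde{\mathfrak{S}}_{d,\delta}$ be the set of permutations of $[d]$ whose one-line notation is $(\gamma'(1),\dots,\gamma'(i),\delta(1),\dots,\delta(d-i))$ for some ordering $\gamma'$ of $\Gamma$, and write $(\gamma,\delta)$ for the permutation with one-line notation $(\gamma(1),\dots,\gamma(i),\delta(1),\dots,\delta(d-i))$. Then $$\sum_{\sigma\in\tilde{\mathfrak{S}}_{d,\delta}}\operatorname{sign}(\sigma)\prod_{j=1}^i\hat z(\sigma,j)=(-1)^{\frac{i(i-1)}{2}}\operatorname{sign}((\gamma,\delta))\det\hat X(\gamma,i).$$ In particular, $$\sum_{\sigma\in\mathfrak{S}_d}\operatorname{sign}(\sigma)\prod_{j=1}^d\hat z(\sigma,j)=(-1)^{\frac{d(d-1)}{2}}\det\hat X(\mathbf{1},d),$$ where $\mathbf{1}$ is the identity permutation.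
   Context: General position: for every $0\le k\le d-1$ and every $(k+1)$-subset $U$ of the vertex set, the image of $\mathrm{conv}(U)$ under the map forgetting the last $d-k$ coordinates is a $k$-simplex. Write $v_i=(x_{i,1},\dots,x_{i,d})$ and $\hat x_{k,j}=x_{k,j}-x_{d+1,j}$ for $1\le k\le d$. For a sequence $\sigma$ of distinct elements of $[d]$ of length at least $k$: $\hat X(\sigma,k)$ is the $k\times k$ matrix with rows $(\hat x_{\sigma(r),1},\dots,\hat x_{\sigma(r),k})$, $r=1,\dots,k$; $\hat Y(\sigma,k)$ is the $k\times k$ matrix with rows $(1,\hat x_{\sigma(r),1},\dots,\hat x_{\sigma(r),k-1})$, $r=1,\dots,k$; $\hat z(\sigma,k)=\det\hat X(\sigma,k)/\det\hat Y(\sigma,k)$. -}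

module Defs where

open import Level using (Level; _⊔_) renaming (suc to lsuc)
open import Algebra.Bundles using (CommutativeRing)
open import Data.Nat as ℕ using (ℕ; zero; suc; _≤_; _<_)
open import Data.Nat.Properties using (n≤1+n; ≤-trans; <⇒≤)
open import Data.Fin as Fin using (Fin; zero; suc; toℕ; inject≤; inject₁; fromℕ; punchIn; splitAt)
open import Data.Fin.Properties using (toℕ<n)
open import Data.Bool using (Bool; true; false; _∧_; _∨_; not; if_then_else_)
open import Data.List using (List; []; _∷_; map; concatMap; foldr)
open import Data.List.Base using (allFin)
import Data.List.Base as List
open import Data.Sum using ([_,_]′)
open import Relation.Nullary using (¬_)
open import Relation.Binary.PropositionalEquality using (_≡_)
open import Relation.Nullary.Decidable using (⌊_⌋)

-- A field: a commutative ring with a multiplicative inverse for every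
-- nonzero element (the value of 0⁻¹ is irrelevant), and 0 ≠ 1.
-- The real numbers ℝ are one instance.

record Field (c ℓ : Level) : Set (lsuc (c ⊔ ℓ)) where
  field
    commutativeRing : CommutativeRing c ℓ
  open CommutativeRing commutativeRing public
  field
    _⁻¹       : Carrier → Carrier
    ⁻¹-inverse : ∀ x → ¬ (x ≈ 0#) → (x * (x ⁻¹)) ≈ 1#
    0≉1       : ¬ (0# ≈ 1#)

cons : ∀ {n m} → Fin m → (Fin n → Fin m) → Fin (suc n) → Fin m
cons a f zero    = a
cons a f (suc x) = f x

allFuns : (n m : ℕ) → List (Fin n → Fin m)
allFuns zero    m = (λ ()) ∷ []
allFuns (suc n) m = concatMap (λ a → map (cons a) (allFuns n m)) (allFin m)

allB : (n : ℕ) → (Fin n → Bool) → Bool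
allB zero    p = true
allB (suc n) p = p zero ∧ allB n (λ x → p (suc x))

anyB : (n : ℕ) → (Fin n → Bool) → Bool
anyB zero    p = false
anyB (suc n) p = p zero ∨ anyB n (λ x → p (suc x))

eqB : ∀ {m} → Fin m → Fin m → Bool
eqB a b = ⌊ a Fin.≟ b ⌋

ltB : ∀ {m} → Fin m → Fin m → Bool
ltB a b = ⌊ a Fin.<? b ⌋

isInjB : ∀ {n m} → (Fin n → Fin m) → Bool
isInjB {n} f = allB n (λ a → allB n (λ b → eqB a b ∨ not (eqB (f a) (f b))))

isSurjB : ∀ {n m} → (Fin n → Fin m) → Bool
isSurjB {n} {m} f = allB m (λ y → anyB n (λ a → eqB (f a) y))

isPermB : ∀ {n} → (Fin n → Fin n) → Bool
isPermB f = isInjB f ∧ isSurjB f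

sameImageB : ∀ {n m} → (Fin n → Fin m) → (Fin n → Fin m) → Bool
sameImageB {n} f g =
  allB n (λ a → anyB n (λ b → eqB (f a) (g b))) ∧
  allB n (λ b → anyB n (λ a → eqB (f a) (g b)))

-- f is an ordering of the set Γ = image of g  (f injective, image f = Γ)
isOrderingOfB : ∀ {n m} → (Fin n → Fin m) → (Fin n → Fin m) → Bool
isOrderingOfB f g = isInjB f ∧ sameImageB f g

sumℕ : (n : ℕ) → (Fin n → ℕ) → ℕ
sumℕ zero    f = 0
sumℕ (suc n) f = f zero ℕ.+ sumℕ n (λ x → f (suc x))

inversions : ∀ {n} → (Fin n → Fin n) → ℕ
inversions {n} σ =
  sumℕ n (λ a → sumℕ n (λ b → if ltB a b ∧ ltB (σ b) (σ a) then 1 else 0))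

concatSeq : ∀ {i e d} → (Fin i → Fin d) → (Fin e → Fin d) → Fin (i ℕ.+ e) → Fin d
concatSeq {i} γ δ x = [ γ , δ ]′ (splitAt i x)

module FieldDefs {c ℓ} (F : Field c ℓ) where
  open Field F using (Carrier; _≈_; _+_; _*_; -_; _-_; 0#; 1#; _⁻¹)

  ∑ : (n : ℕ) → (Fin n → Carrier) → Carrier
  ∑ zero    f = 0#
  ∑ (suc n) f = f zero + ∑ n (λ x → f (suc x))

  ∏ : (n : ℕ) → (Fin n → Carrier) → Carrier
  ∏ zero    f = 1#
  ∏ (suc n) f = f zero * ∏ n (λ x → f (suc x))

  ∑L : ∀ {a} {A : Set a} → List A → (A → Carrier) → Carrier
  ∑L xs f = foldr (λ x acc → f x + acc) 0# xs

  negOnePow : ℕ → Carrier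
  negOnePow zero    = 1#
  negOnePow (suc k) = - (negOnePow k)

  sign : ∀ {n} → (Fin n → Fin n) → Carrier
  sign σ = negOnePow (inversions σ)

  det : (n : ℕ) → (Fin n → Fin n → Carrier) → Carrier
  det zero    M = 1#
  det (suc n) M =
    ∑ (suc n) (λ j → negOnePow (toℕ j) * (M zero j * det n (λ r c → M (suc r) (punchIn j c))))

  -- Vertices v_1,…,v_{d+1} ∈ K^d : v : Fin (suc d) → Fin d → Carrier,
  -- vertex v_{d+1} is  v (fromℕ d).
  Vertices : ℕ → Set c
  Vertices d = Fin (suc d) → Fin d → Carrier

  AffinelyIndependent : (k : ℕ) → (Fin (suc k) → Fin k → Carrier) → Set (c ⊔ ℓ)
  AffinelyIndependent k p =
    (λc : Fin (suc k) → Carrier) →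
    ∑ (suc k) λc ≈ 0# →
    (∀ j → ∑ (suc k) (λ r → λc r * p r j) ≈ 0#) →
    ∀ r → λc r ≈ 0#

  -- General position: for every 0 ≤ k ≤ d-1 and every (k+1)-subset U of
  -- the vertices (given by an injective enumeration u), the projection of
  -- conv(U) to the first k coordinates is a k-simplex, i.e. the projected
  -- points are affinely independent.
  GeneralPosition : (d : ℕ) → Vertices d → Set (c ⊔ ℓ)
  GeneralPosition d v =
    (k : ℕ) (k<d : k < d) (u : Fin (suc k) → Fin (suc d)) →
    (∀ a b → u a ≡ u b → a ≡ b) →
    AffinelyIndependent k (λ r j → v (u r) (inject≤ j (<⇒≤ k<d)))

  xhat : ∀ {d} → Vertices d → Fin d → Fin d → Carrier
  xhat {d} v k j = v (inject₁ k) j - v (fromℕ d) j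

  -- X̂(σ,k): rows (x̂_{σ(r),1},…,x̂_{σ(r),k}), r = 1..k ;
  -- s = the first k entries of σ.
  Xhat : ∀ {d} → Vertices d → (k : ℕ) → k ≤ d → (Fin k → Fin d) → Fin k → Fin k → Carrier
  Xhat v k k≤d s r j = xhat v (s r) (inject≤ j k≤d)

  Yhat : ∀ {d} → Vertices d → (k : ℕ) → k ≤ d → (Fin k → Fin d) → Fin k → Fin k → Carrier
  Yhat v (suc k) k≤d s r zero    = 1#
  Yhat v (suc k) k≤d s r (suc c) = xhat v (s r) (inject≤ c (≤-trans (n≤1+n k) k≤d))

  zhat : ∀ {d m} → Vertices d → (Fin m → Fin d) → (k : ℕ) → k ≤ m → k ≤ d → Carrier
  zhat v σ k k≤m k≤d =
    det k (Xhat v k k≤d (λ r → σ (inject≤ r k≤m))) *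
    (det k (Yhat v k k≤d (λ r → σ (inject≤ r k≤m))) ⁻¹)

  prodZ : ∀ {d m} → Vertices d → (Fin m → Fin d) → (i : ℕ) → i ≤ m → i ≤ d → Carrier
  prodZ v σ i i≤m i≤d =
    ∏ i (λ t → zhat v σ (suc (toℕ t)) (≤-trans (toℕ<n t) i≤m) (≤-trans (toℕ<n t) i≤d))

-- Group the orderings σ of the values of an injective sequence s of
-- length k by their last entry s r.  Reordering the rows of a matrix
-- multiplies its determinant by a sign, the same one for X̂ and Ŷ, so the
-- last factor ẑ(σ, k) = det X̂(σ, k) / det Ŷ(σ, k) equals
-- det X̂(s) / det Ŷ(s).  Deleting the last entry of σ leaves an ordering
-- of s with s r removed, with the same remaining factors and a sign that
-- differs by explicit powers of -1.  By induction the inner sums are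
-- (-1)^((k-1)(k-2)/2) sign(s ∖ s r) det X̂(s ∖ s r), and the sum over r
-- becomes the expansion of det Ŷ(s) along its column of ones, which
-- cancels the denominator.  General position is used only to know that
-- det Ŷ ≠ 0.  A fixed tail δ multiplies every sign by the same factor.
module Submission where

open import Defs
open import Algebra.Bundles using (CommutativeMonoid)
open import Data.Bool using (Bool; true; false; T; _∧_; not; if_then_else_)
open import Data.Bool.Properties using (T-∧; T-∨; T-≡)
open import Data.Empty using (⊥-elim)
open import Data.Fin as Fin
  using (Fin; zero; suc; toℕ; punchIn; punchOut; fromℕ; inject₁; inject≤; _↑ˡ_; _↑ʳ_)
open import Data.Fin.Properties
  using (punchInᵢ≢i; punchIn-punchOut; punchIn-injective; suc-injective; toℕ-↑ˡ; toℕ-↑ʳ; splitAt-↑ˡ; splitAt-↑ʳ)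
import Data.Fin.Properties as Finₚ
open import Data.List using (List; []; map; concatMap; _++_)
import Data.List as List
open import Data.Nat using (ℕ; zero; suc; _≤_; _∸_; _/_) renaming (_+_ to _+ℕ_; _*_ to _*ℕ_)
import Data.Nat as ℕ
open import Data.Nat.DivMod using (+-distrib-/-∣ʳ; m*n/n≡m)
open import Data.Nat.Divisibility using (divides)
open import Data.Nat.Properties using (m≤m+n; ≤-refl)
import Data.Nat.Properties as ℕₚ
open import Data.Nat.Tactic.RingSolver using (solve-∀)
open import Data.Product using (∃-syntax; _×_; _,_; proj₁; proj₂)
open import Data.Sum using (_⊎_; inj₁; inj₂)
open import Data.Vec.Functional using (removeAt; updateAt; _∷_)
open import Data.Vec.Functional.Properties using (updateAt-updates; updateAt-minimal; updateAt-id-local)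
open import Function using (_∘_; _⇔_; mk⇔; Equivalence)
open import Function.Construct.Composition using (_⇔-∘_)
open import Function.Construct.Identity using (⇔-id)
open import Function.Construct.Symmetry using (⇔-sym)
open import Function.Definitions using (Injective)
import Relation.Binary.PropositionalEquality as ≡
open ≡ using (_≡_; _≢_; _≗_; refl)
open import Relation.Binary.Definitions using (tri<; tri≈; tri>)
open import Relation.Nullary using (¬_; yes; no)
open import Relation.Nullary.Decidable
  using (toWitness; fromWitness; toWitnessFalse; fromWitnessFalse; dec-true; dec-false; does-⇔; isYes≗does)

data PunchInView {n} (i : Fin (suc n)) : Fin (suc n) → Set where
  at    : PunchInView i i
  punch : (j : Fin n) → PunchInView i (punchIn i j)

punchInView : ∀ {n} (i j : Fin (suc n)) → PunchInView i j
punchInView i j with i Fin.≟ j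
... | yes refl = at
... | no i≢j   rewrite ≡.sym (punchIn-punchOut i≢j) = punch (punchOut i≢j)

punchIn-fromℕ : ∀ {n} (i : Fin n) → punchIn (fromℕ n) i ≡ inject₁ i
punchIn-fromℕ zero    = refl
punchIn-fromℕ (suc i) = ≡.cong suc (punchIn-fromℕ i)

toℕ-punchOut-< : ∀ {n} {j k : Fin (suc n)} (j≢k : j ≢ k) → toℕ j ℕ.< toℕ k →
                 suc (toℕ (punchOut j≢k)) ≡ toℕ k
toℕ-punchOut-< {j = zero}  {zero}  j≢k ()
toℕ-punchOut-< {j = zero}  {suc k} j≢k j<k = refl
toℕ-punchOut-< {suc n} {suc j} {suc k} j≢k j<k =
  ≡.cong suc (toℕ-punchOut-< (j≢k ∘ ≡.cong suc) (ℕ.s<s⁻¹ j<k))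

toℕ-punchOut-> : ∀ {n} {j k : Fin (suc n)} (j≢k : j ≢ k) → toℕ k ℕ.< toℕ j →
                 toℕ (punchOut j≢k) ≡ toℕ k
toℕ-punchOut-> {suc n} {suc j} {zero}  j≢k k<j = refl
toℕ-punchOut-> {suc n} {suc j} {suc k} j≢k k<j =
  ≡.cong suc (toℕ-punchOut-> (j≢k ∘ ≡.cong suc) (ℕ.s<s⁻¹ k<j))

-- Deleting j and then k, or k and then j, leaves the same positions.
punchIn-punchOut-comm : ∀ {n} {j k : Fin (suc (suc n))} (j≢k : j ≢ k) (k≢j : k ≢ j) →
  punchIn j ∘ punchIn (punchOut j≢k) ≗ punchIn k ∘ punchIn (punchOut k≢j)
punchIn-punchOut-comm {j = zero}  {zero}  j≢k k≢j x = ⊥-elim (j≢k refl)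
punchIn-punchOut-comm {j = zero}  {suc k} j≢k k≢j x = refl
punchIn-punchOut-comm {j = suc j} {zero}  j≢k k≢j x = refl
punchIn-punchOut-comm {suc n} {suc j} {suc k} j≢k k≢j zero    = refl
punchIn-punchOut-comm {suc n} {suc j} {suc k} j≢k k≢j (suc x) =
  ≡.cong suc (punchIn-punchOut-comm (j≢k ∘ ≡.cong suc) (k≢j ∘ ≡.cong suc) x)

-- Rearrangements of injective sequences

Injective≡ : ∀ {k D} → (Fin k → Fin D) → Set
Injective≡ = Injective _≡_ _≡_

removeAt-injective : ∀ {k D} {s : Fin (suc k) → Fin D} r → Injective≡ s → Injective≡ (removeAt s r)
removeAt-injective r s-inj = punchIn-injective r _ _ ∘ s-inj

record _↭_ {k D} (σ s : Fin k → Fin D) : Set where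
  field
    injectiveˡ : Injective≡ σ
    injectiveʳ : Injective≡ s
    toʳ        : ∀ a → ∃[ b ] σ a ≡ s b
    toˡ        : ∀ b → ∃[ a ] s b ≡ σ a

open _↭_

↭-respˡ : ∀ {k D} {σ τ s : Fin k → Fin D} → σ ≗ τ → σ ↭ s → τ ↭ s
↭-respˡ σ≗τ σ↭s = record
  { injectiveˡ = λ {a} {b} eq → injectiveˡ σ↭s (≡.trans (σ≗τ a) (≡.trans eq (≡.sym (σ≗τ b))))
  ; injectiveʳ = injectiveʳ σ↭s
  ; toʳ        = λ a → let b , eq = toʳ σ↭s a in b , ≡.trans (≡.sym (σ≗τ a)) eq
  ; toˡ        = λ b → let a , eq = toˡ σ↭s b in a , ≡.trans eq (σ≗τ a)
  }

↭-removeAt : ∀ {k D} {σ s : Fin (suc k) → Fin D} {q r} →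
             σ ↭ s → σ q ≡ s r → removeAt σ q ↭ removeAt s r
↭-removeAt {σ = σ} {s} {q} {r} σ↭s σq≡sr = record
  { injectiveˡ = removeAt-injective q (injectiveˡ σ↭s)
  ; injectiveʳ = removeAt-injective r (injectiveʳ σ↭s)
  ; toʳ        = toʳ′
  ; toˡ        = toˡ′
  }
  where
  toʳ′ : ∀ a → ∃[ b ] σ (punchIn q a) ≡ s (punchIn r b)
  toʳ′ a with toʳ σ↭s (punchIn q a)
  ... | b , eq with punchInView r b
  ...   | at      = ⊥-elim (punchInᵢ≢i q a (injectiveˡ σ↭s (≡.trans eq (≡.sym σq≡sr))))
  ...   | punch c = c , eq
  toˡ′ : ∀ b → ∃[ a ] s (punchIn r b) ≡ σ (punchIn q a)
  toˡ′ b with toˡ σ↭s (punchIn r b)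
  ... | a , eq with punchInView q a
  ...   | at      = ⊥-elim (punchInᵢ≢i r b (injectiveʳ σ↭s (≡.trans eq σq≡sr)))
  ...   | punch c = c , eq

↭-fromRemoveAt : ∀ {k D} {σ s : Fin (suc k) → Fin D} {q r} → Injective≡ s →
                 σ q ≡ s r → removeAt σ q ↭ removeAt s r → σ ↭ s
↭-fromRemoveAt {σ = σ} {s} {q} {r} s-inj σq≡sr rest = record
  { injectiveˡ = injσ
  ; injectiveʳ = s-inj
  ; toʳ        = toʳ′
  ; toˡ        = toˡ′
  }
  where
  σq-fresh : ∀ a → σ q ≢ σ (punchIn q a)
  σq-fresh a eq =
    let b , eq′ = toʳ rest a
    in punchInᵢ≢i r b (≡.sym (s-inj (≡.trans (≡.sym σq≡sr) (≡.trans eq eq′))))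
  injσ : Injective≡ σ
  injσ {a} {b} eq with punchInView q a | punchInView q b
  ... | at      | at      = refl
  ... | at      | punch d = ⊥-elim (σq-fresh d eq)
  ... | punch c | at      = ⊥-elim (σq-fresh c (≡.sym eq))
  ... | punch c | punch d = ≡.cong (punchIn q) (injectiveˡ rest eq)
  toʳ′ : ∀ a → ∃[ b ] σ a ≡ s b
  toʳ′ a with punchInView q a
  ... | at      = r , σq≡sr
  ... | punch c = let b , eq = toʳ rest c in punchIn r b , eq
  toˡ′ : ∀ b → ∃[ a ] s b ≡ σ a
  toˡ′ b with punchInView r b
  ... | at      = q , ≡.sym σq≡sr
  ... | punch d = let a , eq = toˡ rest d in punchIn q a , eq

-- Appending at the end; defined through Defs.cons so that
-- cons b (snoc f a) and snoc (cons b f) a agree definitionally.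
snoc : ∀ {n m} → (Fin n → Fin m) → Fin m → Fin (suc n) → Fin m
snoc {zero}  f a = cons a f
snoc {suc n} f a = cons (f zero) (snoc (f ∘ suc) a)

snoc-last : ∀ {n m} (f : Fin n → Fin m) a → snoc f a (fromℕ n) ≡ a
snoc-last {zero}  f a = refl
snoc-last {suc n} f a = snoc-last (f ∘ suc) a

snoc-inject₁ : ∀ {n m} (f : Fin n → Fin m) a b → snoc f a (inject₁ b) ≡ f b
snoc-inject₁ {suc n} f a zero    = refl
snoc-inject₁ {suc n} f a (suc b) = snoc-inject₁ (f ∘ suc) a b

snoc-punchIn : ∀ {n m} (f : Fin n → Fin m) a b → snoc f a (punchIn (fromℕ n) b) ≡ f b
snoc-punchIn f a b = ≡.trans (≡.cong (snoc f a) (punchIn-fromℕ b)) (snoc-inject₁ f a b)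

snoc-↭ : ∀ {k D} {s : Fin (suc k) → Fin D} {f : Fin k → Fin D} r → Injective≡ s →
         snoc f (s r) ↭ s ⇔ f ↭ removeAt s r
snoc-↭ {k} {s = s} {f} r s-inj = mk⇔
  (λ σ↭s → ↭-respˡ (snoc-punchIn f (s r)) (↭-removeAt σ↭s (snoc-last f (s r))))
  (λ f↭s′ → ↭-fromRemoveAt s-inj (snoc-last f (s r))
              (↭-respˡ (≡.sym ∘ snoc-punchIn f (s r)) f↭s′))

snoc-≁ : ∀ {k D} {s : Fin (suc k) → Fin D} {a} → (∀ r → s r ≢ a) →
         (f : Fin k → Fin D) → ¬ (snoc f a ↭ s)
snoc-≁ {k} a∉s f σ↭s =
  let r , eq = toʳ σ↭s (fromℕ k) in a∉s r (≡.trans (≡.sym eq) (snoc-last f _))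

T-allB : ∀ n {p : Fin n → Bool} → T (allB n p) ⇔ (∀ x → T (p x))
T-allB zero    = mk⇔ (λ _ ()) _
T-allB (suc n) = mk⇔
  (λ t → let t₀ , t₊ = Equivalence.to T-∧ t in
         λ { zero → t₀ ; (suc x) → Equivalence.to (T-allB n) t₊ x })
  (λ h → Equivalence.from T-∧ (h zero , Equivalence.from (T-allB n) (h ∘ suc)))

T-anyB : ∀ n {p : Fin n → Bool} → T (anyB n p) ⇔ (∃[ x ] T (p x))
T-anyB zero    = mk⇔ (λ ()) (λ ())
T-anyB (suc n) {p} = mk⇔ to from
  where
  to : T (anyB (suc n) p) → ∃[ x ] T (p x)
  to t with Equivalence.to T-∨ t
  ... | inj₁ t₀ = zero , t₀
  ... | inj₂ t₊ = let x , tx = Equivalence.to (T-anyB n) t₊ in suc x , tx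
  from : ∃[ x ] T (p x) → T (anyB (suc n) p)
  from (zero  , t₀) = Equivalence.from T-∨ (inj₁ t₀)
  from (suc x , tx) = Equivalence.from T-∨ (inj₂ (Equivalence.from (T-anyB n) (x , tx)))

T-isInjB : ∀ {n m} (f : Fin n → Fin m) → T (isInjB f) ⇔ Injective≡ f
T-isInjB {n} f = mk⇔ to from
  where
  to : T (isInjB f) → Injective≡ f
  to t {a} {b} fa≡fb
    with Equivalence.to (T-∨ {eqB a b}) (Equivalence.to (T-allB n) (Equivalence.to (T-allB n) t a) b)
  ... | inj₁ a≡b   = toWitness {a? = a Fin.≟ b} a≡b
  ... | inj₂ fa≢fb = ⊥-elim (toWitnessFalse {a? = f a Fin.≟ f b} fa≢fb fa≡fb)
  from : Injective≡ f → T (isInjB f)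
  from f-inj = Equivalence.from (T-allB n) λ a → Equivalence.from (T-allB n) λ b →
    Equivalence.from T-∨ (decide a b)
    where
    decide : ∀ a b → T (eqB a b) ⊎ T (not (eqB (f a) (f b)))
    decide a b with a Fin.≟ b
    ... | yes a≡b = inj₁ _
    ... | no  a≢b = inj₂ (fromWitnessFalse (a≢b ∘ f-inj))

T-eqB : ∀ {m} {a b : Fin m} → T (eqB a b) ⇔ a ≡ b
T-eqB = mk⇔ toWitness fromWitness

T-isOrderingOfB : ∀ {k D} {σ s : Fin k → Fin D} → Injective≡ s →
                  T (isOrderingOfB σ s) ⇔ σ ↭ s
T-isOrderingOfB {k} {σ = σ} {s} s-inj = mk⇔ to from
  where
  to : T (isOrderingOfB σ s) → σ ↭ s
  to t = let tσ , tim = Equivalence.to T-∧ t ; tʳ , tˡ = Equivalence.to T-∧ tim in record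
    { injectiveˡ = Equivalence.to (T-isInjB σ) tσ
    ; injectiveʳ = s-inj
    ; toʳ = λ a → let b , e = Equivalence.to (T-anyB k) (Equivalence.to (T-allB k) tʳ a) in
                  b , Equivalence.to T-eqB e
    ; toˡ = λ b → let a , e = Equivalence.to (T-anyB k) (Equivalence.to (T-allB k) tˡ b) in
                  a , ≡.sym (Equivalence.to T-eqB e)
    }
  from : σ ↭ s → T (isOrderingOfB σ s)
  from σ↭s = Equivalence.from T-∧ (Equivalence.from (T-isInjB σ) (injectiveˡ σ↭s) ,
    Equivalence.from T-∧
      ( Equivalence.from (T-allB k) (λ a → let b , e = toʳ σ↭s a in
          Equivalence.from (T-anyB k) (b , Equivalence.from T-eqB e))
      , Equivalence.from (T-allB k) (λ b → let a , e = toˡ σ↭s b in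
          Equivalence.from (T-anyB k) (a , Equivalence.from T-eqB (≡.sym e)))))

isPermB≡isOrderingOfB-id : ∀ {n} (σ : Fin n → Fin n) → isPermB σ ≡ isOrderingOfB σ (λ r → r)
isPermB≡isOrderingOfB-id {n} σ = ≡.sym (≡.cong (λ t → isInjB σ ∧ (t ∧ isSurjB σ)) (Equivalence.to T-≡
  (Equivalence.from (T-allB n) λ a → Equivalence.from (T-anyB n) (σ a , Equivalence.from T-eqB refl))))

module CommutativeMonoidSums {c ℓ} (M : CommutativeMonoid c ℓ) where

  open CommutativeMonoid M renaming (refl to ≈-refl)
  open import Algebra.Properties.CommutativeMonoid.Sum M public

  sum-zero : ∀ {n} {f : Fin n → Carrier} → (∀ x → f x ≈ ε) → sum f ≈ ε
  sum-zero {n} f≈0 = trans (sum-cong-≋ f≈0) (sum-replicate-zero n)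

  sum-↭ : ∀ {k D} {σ s : Fin k → Fin D} → σ ↭ s → (g : Fin D → Carrier) →
          sum (g ∘ σ) ≈ sum (g ∘ s)
  sum-↭ {zero}          σ↭s g = ≈-refl
  sum-↭ {suc k} {σ = σ} {s} σ↭s g =
    let r , σ₀≡sr = toʳ σ↭s zero in begin
    g (σ zero) ∙ sum (g ∘ σ ∘ suc)
      ≈⟨ ∙-cong (reflexive (≡.cong g σ₀≡sr)) (sum-↭ (↭-removeAt σ↭s σ₀≡sr) g) ⟩
    g (s r) ∙ sum (removeAt (g ∘ s) r)
      ≈⟨ sym (sum-remove (g ∘ s)) ⟩
    sum (g ∘ s) ∎
    where open import Relation.Binary.Reasoning.Setoid setoid

  sum-image : ∀ {n D} {s : Fin n → Fin D} → Injective≡ s → (K : Fin D → Carrier) →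
              (∀ a → (∀ r → s r ≢ a) → K a ≈ ε) → sum K ≈ sum (K ∘ s)
  sum-image {zero}          s-inj K K≈0 = sum-zero (λ a → K≈0 a (λ ()))
  sum-image {suc n} {zero}  {s} s-inj K K≈0 with s zero
  ... | ()
  sum-image {suc n} {suc D} {s} s-inj K K≈0 = begin
    sum K                                      ≈⟨ sum-remove K ⟩
    K (s zero) ∙ sum (removeAt K (s zero))     ≈⟨ ∙-cong ≈-refl (sum-image s′-inj _ K′≈0) ⟩
    K (s zero) ∙ sum (removeAt K (s zero) ∘ s′) ≡⟨ ≡.cong (K (s zero) ∙_) (sum-cong-≗ (≡.cong K ∘ punchIn-s′)) ⟩
    sum (K ∘ s)                                ∎
    where
    open import Relation.Binary.Reasoning.Setoid setoid
    s₀≢ : ∀ r → s zero ≢ s (suc r)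
    s₀≢ r = (λ ()) ∘ s-inj
    s′ : Fin n → Fin D
    s′ r = punchOut (s₀≢ r)
    punchIn-s′ : ∀ r → punchIn (s zero) (s′ r) ≡ s (suc r)
    punchIn-s′ r = punchIn-punchOut (s₀≢ r)
    s′-inj : Injective≡ s′
    s′-inj {x} {y} eq = suc-injective (s-inj
      (≡.trans (≡.sym (punchIn-s′ x)) (≡.trans (≡.cong (punchIn (s zero)) eq) (punchIn-s′ y))))
    K′≈0 : ∀ a → (∀ r → s′ r ≢ a) → removeAt K (s zero) a ≈ ε
    K′≈0 a a∉s′ = K≈0 (punchIn (s zero) a) avoid
      where
      avoid : ∀ r → s r ≢ punchIn (s zero) a
      avoid zero    eq = punchInᵢ≢i (s zero) a (≡.sym eq)
      avoid (suc r) eq = a∉s′ r (punchIn-injective (s zero) _ _ (≡.trans (punchIn-s′ r) eq))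

-- Inversions

ltB-⇔ : ∀ {m n} {x y : Fin m} {a b : Fin n} →
        toℕ x ℕ.< toℕ y ⇔ toℕ a ℕ.< toℕ b → ltB x y ≡ ltB a b
ltB-⇔ {x = x} {y} {a} {b} x<y⇔a<b = ≡.trans (isYes≗does (x Fin.<? y))
  (≡.trans (does-⇔ x<y⇔a<b (x Fin.<? y) (a Fin.<? b)) (≡.sym (isYes≗does (a Fin.<? b))))

ltB-true : ∀ {m} {a b : Fin m} → a Fin.< b → ltB a b ≡ true
ltB-true {a = a} {b} a<b = ≡.trans (isYes≗does (a Fin.<? b)) (dec-true (a Fin.<? b) a<b)

ltB-false : ∀ {m} {a b : Fin m} → ¬ a Fin.< b → ltB a b ≡ false
ltB-false {a = a} {b} a≮b = ≡.trans (isYes≗does (a Fin.<? b)) (dec-false (a Fin.<? b) a≮b)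

ltB-toℕ : ∀ {m n} {x y : Fin m} {a b : Fin n} →
          toℕ x ≡ toℕ a → toℕ y ≡ toℕ b → ltB x y ≡ ltB a b
ltB-toℕ x≡a y≡b = ltB-⇔ (mk⇔ (≡.subst₂ ℕ._<_ x≡a y≡b) (≡.subst₂ ℕ._<_ (≡.sym x≡a) (≡.sym y≡b)))

ltB-suc : ∀ {m} (a b : Fin m) → ltB (suc a) (suc b) ≡ ltB a b
ltB-suc a b = ltB-⇔ (mk⇔ ℕ.s<s⁻¹ ℕ.s<s)

module ℕΣ = CommutativeMonoidSums ℕₚ.+-0-commutativeMonoid

sumℕ≡sum : ∀ n (f : Fin n → ℕ) → sumℕ n f ≡ ℕΣ.sum f
sumℕ≡sum zero    f = refl
sumℕ≡sum (suc n) f = ≡.cong (f zero +ℕ_) (sumℕ≡sum n (f ∘ suc))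

sumℕ-cong : ∀ n {f g : Fin n → ℕ} → f ≗ g → sumℕ n f ≡ sumℕ n g
sumℕ-cong zero    f≗g = refl
sumℕ-cong (suc n) f≗g = ≡.cong₂ _+ℕ_ (f≗g zero) (sumℕ-cong n (f≗g ∘ suc))

[_<_] : ∀ {D} → Fin D → Fin D → ℕ
[ x < y ] = if ltB x y then 1 else 0

countBelow : ∀ {k D} → Fin D → (Fin k → Fin D) → ℕ
countBelow {k} x f = sumℕ k (λ b → [ f b < x ])

inverted : ∀ {D} → Bool → Fin D → Fin D → ℕ
inverted a<b x y = if a<b ∧ ltB y x then 1 else 0

-- Defs.inversions for sequences Fin k → Fin D; on Fin n → Fin n the two
-- agree definitionally.
inversions′ : ∀ {k D} → (Fin k → Fin D) → ℕ
inversions′ {k} f = sumℕ k (λ a → sumℕ k (λ b → inverted (ltB a b) (f a) (f b)))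

sumℕ-+ : ∀ n (f g : Fin n → ℕ) → sumℕ n (λ x → f x +ℕ g x) ≡ sumℕ n f +ℕ sumℕ n g
sumℕ-+ n f g = ≡.trans (sumℕ≡sum n _) (≡.trans (ℕΣ.∑-distrib-+ f g)
                 (≡.sym (≡.cong₂ _+ℕ_ (sumℕ≡sum n f) (sumℕ≡sum n g))))

sumℕ-zero : ∀ n {f : Fin n → ℕ} → (∀ x → f x ≡ 0) → sumℕ n f ≡ 0
sumℕ-zero n f≡0 = ≡.trans (sumℕ≡sum n _) (ℕΣ.sum-zero f≡0)

sumℕ-remove : ∀ n (f : Fin (suc n) → ℕ) i → sumℕ (suc n) f ≡ f i +ℕ sumℕ n (removeAt f i)
sumℕ-remove n f i = ≡.trans (sumℕ≡sum (suc n) f)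
  (≡.trans (ℕΣ.sum-remove f) (≡.cong (f i +ℕ_) (≡.sym (sumℕ≡sum n _))))

sumℕ-++ : ∀ i e (g : Fin (i +ℕ e) → ℕ) →
          sumℕ (i +ℕ e) g ≡ sumℕ i (λ a → g (a ↑ˡ e)) +ℕ sumℕ e (λ b → g (i ↑ʳ b))
sumℕ-++ zero    e g = refl
sumℕ-++ (suc i) e g = ≡.trans (≡.cong (g zero +ℕ_) (sumℕ-++ i e (g ∘ suc)))
                              (≡.sym (ℕₚ.+-assoc (g zero) _ _))

countBelow-↭ : ∀ {k D} x {f g : Fin k → Fin D} → f ↭ g → countBelow x f ≡ countBelow x g
countBelow-↭ {k} x {f} {g} f↭g = ≡.trans (sumℕ≡sum k _)
  (≡.trans (ℕΣ.sum-↭ f↭g (λ y → [ y < x ])) (≡.sym (sumℕ≡sum k _)))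

countBelow-cong : ∀ {k D} x {f g : Fin k → Fin D} → f ≗ g → countBelow x f ≡ countBelow x g
countBelow-cong {k} x f≗g = sumℕ-cong k (λ b → ≡.cong [_< x ] (f≗g b))

inversions′-cong : ∀ {k D} {f g : Fin k → Fin D} → f ≗ g → inversions′ f ≡ inversions′ g
inversions′-cong {k} f≗g = sumℕ-cong k λ a → sumℕ-cong k λ b → ≡.cong₂ (inverted _) (f≗g a) (f≗g b)

inverted-cong : ∀ {D} {p p′ : Bool} {x x′ y y′ : Fin D} →
                p ≡ p′ → x ≡ x′ → y ≡ y′ → inverted p x y ≡ inverted p′ x′ y′
inverted-cong refl refl refl = refl

inversions′-cons : ∀ {k D} (σ : Fin (suc k) → Fin D) →
                   inversions′ σ ≡ countBelow (σ zero) (σ ∘ suc) +ℕ inversions′ (σ ∘ suc)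
inversions′-cons {k} σ = ≡.cong (countBelow (σ zero) (σ ∘ suc) +ℕ_)
  (sumℕ-cong k λ a → sumℕ-cong k λ b → inverted-cong (ltB-suc a b) refl refl)

inversions′-id : ∀ n → inversions′ {n} (λ r → r) ≡ 0
inversions′-id n = sumℕ-zero n λ a → sumℕ-zero n λ b → ≡.cong (λ t → if t then 1 else 0) (asym a b)
  where
  asym : ∀ (a b : Fin n) → ltB a b ∧ ltB b a ≡ false
  asym a b with a Fin.<? b
  ... | no  _   = refl
  ... | yes a<b = ltB-false (Finₚ.<-asym a<b)

-- the inversions of concatSeq f δ between its f-part and its δ-part
crossings : ∀ {i e D} → (Fin i → Fin D) → (Fin e → Fin D) → ℕ
crossings {i} f δ = sumℕ i (λ a → countBelow (f a) δ)

crossings-↭ : ∀ {i e D} {f g : Fin i → Fin D} (δ : Fin e → Fin D) →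
              f ↭ g → crossings f δ ≡ crossings g δ
crossings-↭ {i} {f = f} {g} δ f↭g = ≡.trans (sumℕ≡sum i _)
  (≡.trans (ℕΣ.sum-↭ f↭g (λ x → countBelow x δ)) (≡.sym (sumℕ≡sum i _)))

module _ {i e D : ℕ} (f : Fin i → Fin D) (δ : Fin e → Fin D) where

  concatSeq-↑ˡ : ∀ a → concatSeq f δ (a ↑ˡ e) ≡ f a
  concatSeq-↑ˡ a rewrite splitAt-↑ˡ i a e = refl

  concatSeq-↑ʳ : ∀ b → concatSeq f δ (i ↑ʳ b) ≡ δ b
  concatSeq-↑ʳ b rewrite splitAt-↑ʳ i e b = refl

  inversions′-concatSeq : inversions′ (concatSeq f δ) ≡ inversions′ f +ℕ (crossings f δ +ℕ inversions′ δ)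
  inversions′-concatSeq = begin
    inversions′ σ
      ≡⟨ sumℕ-++ i e _ ⟩
    sumℕ i (λ a → row (a ↑ˡ e)) +ℕ sumℕ e (λ b → row (i ↑ʳ b))
      ≡⟨ ≡.cong₂ _+ℕ_ (sumℕ-cong i λ a → sumℕ-++ i e _) (sumℕ-cong e λ b → sumℕ-++ i e _) ⟩
    sumℕ i (λ a → sumℕ i (λ a′ → t (a ↑ˡ e) (a′ ↑ˡ e)) +ℕ sumℕ e (λ b → t (a ↑ˡ e) (i ↑ʳ b))) +ℕ
    sumℕ e (λ b → sumℕ i (λ a → t (i ↑ʳ b) (a ↑ˡ e)) +ℕ sumℕ e (λ b′ → t (i ↑ʳ b) (i ↑ʳ b′)))
      ≡⟨ ≡.cong₂ _+ℕ_
           (sumℕ-cong i λ a → ≡.cong₂ _+ℕ_ (sumℕ-cong i (left-left a)) (sumℕ-cong e (left-right a)))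
           (sumℕ-cong e λ b → ≡.cong₂ _+ℕ_ (sumℕ-zero i (right-left b)) (sumℕ-cong e (right-right b))) ⟩
    sumℕ i (λ a → sumℕ i (λ a′ → inverted (ltB a a′) (f a) (f a′)) +ℕ countBelow (f a) δ) +ℕ
    inversions′ δ
      ≡⟨ ≡.cong (_+ℕ inversions′ δ) (sumℕ-+ i _ _) ⟩
    inversions′ f +ℕ crossings f δ +ℕ inversions′ δ
      ≡⟨ ℕₚ.+-assoc (inversions′ f) _ _ ⟩
    inversions′ f +ℕ (crossings f δ +ℕ inversions′ δ) ∎
    where
    open ≡.≡-Reasoning
    σ = concatSeq f δ
    t : Fin (i +ℕ e) → Fin (i +ℕ e) → ℕ
    t x y = inverted (ltB x y) (σ x) (σ y)
    row : Fin (i +ℕ e) → ℕ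
    row x = sumℕ (i +ℕ e) (t x)
    left-left : ∀ a a′ → t (a ↑ˡ e) (a′ ↑ˡ e) ≡ inverted (ltB a a′) (f a) (f a′)
    left-left a a′ = inverted-cong (ltB-toℕ (toℕ-↑ˡ a e) (toℕ-↑ˡ a′ e))
                       (concatSeq-↑ˡ a) (concatSeq-↑ˡ a′)
    left<right : ∀ a b → toℕ (a ↑ˡ e) ℕ.< toℕ (i ↑ʳ b)
    left<right a b = ≡.subst₂ ℕ._<_ (≡.sym (toℕ-↑ˡ a e)) (≡.sym (toℕ-↑ʳ i b))
                       (ℕₚ.<-≤-trans (Finₚ.toℕ<n a) (m≤m+n i (toℕ b)))
    left-right : ∀ a b → t (a ↑ˡ e) (i ↑ʳ b) ≡ [ δ b < f a ]
    left-right a b = inverted-cong (ltB-true (left<right a b)) (concatSeq-↑ˡ a) (concatSeq-↑ʳ b)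
    right-left : ∀ b a → t (i ↑ʳ b) (a ↑ˡ e) ≡ 0
    right-left b a = inverted-cong (ltB-false (ℕₚ.<-asym (left<right a b))) refl refl
    right-right : ∀ b b′ → t (i ↑ʳ b) (i ↑ʳ b′) ≡ inverted (ltB b b′) (δ b) (δ b′)
    right-right b b′ = inverted-cong (ltB-⇔ (mk⇔ to from)) (concatSeq-↑ʳ b) (concatSeq-↑ʳ b′)
      where
      to : toℕ (i ↑ʳ b) ℕ.< toℕ (i ↑ʳ b′) → toℕ b ℕ.< toℕ b′
      to lt = ℕₚ.+-cancelˡ-< i _ _ (≡.subst₂ ℕ._<_ (toℕ-↑ʳ i b) (toℕ-↑ʳ i b′) lt)
      from : toℕ b ℕ.< toℕ b′ → toℕ (i ↑ʳ b) ℕ.< toℕ (i ↑ʳ b′)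
      from lt = ≡.subst₂ ℕ._<_ (≡.sym (toℕ-↑ʳ i b)) (≡.sym (toℕ-↑ʳ i b′)) (ℕₚ.+-monoʳ-< i lt)

triangular-suc : ∀ k → (suc k *ℕ (suc k ∸ 1)) / 2 ≡ (k *ℕ (k ∸ 1)) / 2 +ℕ k
triangular-suc zero    = refl
triangular-suc (suc k) = begin
  (suc (suc k) *ℕ suc k) / 2              ≡⟨ ≡.cong (ℕ._/ 2) (expand k) ⟩
  (suc k *ℕ k +ℕ suc k *ℕ 2) / 2          ≡⟨ +-distrib-/-∣ʳ (suc k *ℕ k) (divides (suc k) refl) ⟩
  (suc k *ℕ k) / 2 +ℕ (suc k *ℕ 2) / 2  ≡⟨ ≡.cong ((suc k *ℕ k) / 2 +ℕ_) (m*n/n≡m (suc k) 2) ⟩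
  (suc k *ℕ k) / 2 +ℕ suc k                ∎
  where
  open ≡.≡-Reasoning
  expand : ∀ k → suc (suc k) *ℕ suc k ≡ suc k *ℕ k +ℕ suc k *ℕ 2
  expand = solve-∀

module LinearAlgebra {c ℓ} (F : Field c ℓ) where

  open Field F hiding (zero) renaming (refl to ≈-refl)
  open FieldDefs F
  open import Relation.Binary.Reasoning.Setoid setoid
  open import Algebra.Properties.Ring ring using (-‿distribˡ-*; -‿distribʳ-*; -0#≈0#)
  open import Algebra.Properties.AbelianGroup +-abelianGroup using (⁻¹-involutive; ⁻¹-∙-comm)
  open import Algebra.Properties.CommutativeSemigroup *-commutativeSemigroup using (x∙yz≈y∙xz; interchange)
  open import Algebra.Solver.Ring.NaturalCoefficients.Default commutativeSemiring
    using (solve; _:*_; _:+_; _:=_)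
  module Σ = CommutativeMonoidSums +-commutativeMonoid
  module Π = CommutativeMonoidSums *-commutativeMonoid
  open import Algebra.Properties.Semiring.Sum semiring using (*-distribˡ-sum)

  ∑≡sum : ∀ n (f : Fin n → Carrier) → ∑ n f ≡ Σ.sum f
  ∑≡sum zero    f = refl
  ∑≡sum (suc n) f = ≡.cong (f zero +_) (∑≡sum n (f ∘ suc))

  ∏≡product : ∀ n (f : Fin n → Carrier) → ∏ n f ≡ Π.sum f
  ∏≡product zero    f = refl
  ∏≡product (suc n) f = ≡.cong (f zero *_) (∏≡product n (f ∘ suc))

  ∑-cong : ∀ n {f g : Fin n → Carrier} → (∀ x → f x ≈ g x) → ∑ n f ≈ ∑ n g
  ∑-cong zero    f≈g = ≈-refl
  ∑-cong (suc n) f≈g = +-cong (f≈g zero) (∑-cong n (f≈g ∘ suc))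

  ∑-cong≡ : ∀ n {f g : Fin n → Carrier} → f ≗ g → ∑ n f ≡ ∑ n g
  ∑-cong≡ zero    f≗g = refl
  ∑-cong≡ (suc n) f≗g = ≡.cong₂ _+_ (f≗g zero) (∑-cong≡ n (f≗g ∘ suc))

  ∏-cong : ∀ n {f g : Fin n → Carrier} → (∀ x → f x ≈ g x) → ∏ n f ≈ ∏ n g
  ∏-cong zero    f≈g = ≈-refl
  ∏-cong (suc n) f≈g = *-cong (f≈g zero) (∏-cong n (f≈g ∘ suc))

  ∑-zero : ∀ n {f : Fin n → Carrier} → (∀ x → f x ≈ 0#) → ∑ n f ≈ 0#
  ∑-zero n f≈0 = trans (reflexive (∑≡sum n _)) (Σ.sum-zero f≈0)

  ∑-remove : ∀ n (f : Fin (suc n) → Carrier) i → ∑ (suc n) f ≈ f i + ∑ n (removeAt f i)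
  ∑-remove n f i = begin
    ∑ (suc n) f                   ≡⟨ ∑≡sum (suc n) f ⟩
    Σ.sum f                       ≈⟨ Σ.sum-remove f ⟩
    f i + Σ.sum (removeAt f i)    ≡⟨ ≡.cong (f i +_) (∑≡sum n _) ⟨
    f i + ∑ n (removeAt f i)      ∎

  ∑-distrib-+ : ∀ n (f g : Fin n → Carrier) → ∑ n (λ x → f x + g x) ≈ ∑ n f + ∑ n g
  ∑-distrib-+ n f g = begin
    ∑ n (λ x → f x + g x)   ≡⟨ ∑≡sum n _ ⟩
    Σ.sum (λ x → f x + g x) ≈⟨ Σ.∑-distrib-+ f g ⟩
    Σ.sum f + Σ.sum g       ≡⟨ ≡.cong₂ _+_ (∑≡sum n f) (∑≡sum n g) ⟨
    ∑ n f + ∑ n g           ∎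

  ∑-comm : ∀ m n (f : Fin m → Fin n → Carrier) →
           ∑ m (λ i → ∑ n (f i)) ≈ ∑ n (λ j → ∑ m (λ i → f i j))
  ∑-comm m n f = begin
    ∑ m (λ i → ∑ n (f i))                 ≡⟨ ≡.trans (∑-cong≡ m (λ i → ∑≡sum n (f i))) (∑≡sum m _) ⟩
    Σ.sum (λ i → Σ.sum (f i))             ≈⟨ Σ.∑-comm f ⟩
    Σ.sum (λ j → Σ.sum (λ i → f i j))     ≡⟨ ≡.trans (∑-cong≡ n (λ j → ∑≡sum m _)) (∑≡sum n _) ⟨
    ∑ n (λ j → ∑ m (λ i → f i j))         ∎

  *-distribˡ-∑ : ∀ n x (f : Fin n → Carrier) → x * ∑ n f ≈ ∑ n (λ i → x * f i)
  *-distribˡ-∑ n x f = begin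
    x * ∑ n f               ≡⟨ ≡.cong (x *_) (∑≡sum n f) ⟩
    x * Σ.sum f             ≈⟨ *-distribˡ-sum x f ⟩
    Σ.sum (λ i → x * f i)   ≡⟨ ∑≡sum n _ ⟨
    ∑ n (λ i → x * f i)     ∎

  ∑-image : ∀ n D {s : Fin n → Fin D} → Injective≡ s → (K : Fin D → Carrier) →
            (∀ a → (∀ r → s r ≢ a) → K a ≈ 0#) → ∑ D K ≈ ∑ n (K ∘ s)
  ∑-image n D {s} s-inj K K≈0 = begin
    ∑ D K          ≡⟨ ∑≡sum D K ⟩
    Σ.sum K        ≈⟨ Σ.sum-image s-inj K K≈0 ⟩
    Σ.sum (K ∘ s)  ≡⟨ ∑≡sum n (K ∘ s) ⟨
    ∑ n (K ∘ s)    ∎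

  ∏-init-last : ∀ n (f : Fin (suc n) → Carrier) → ∏ (suc n) f ≈ ∏ n (f ∘ inject₁) * f (fromℕ n)
  ∏-init-last n f = begin
    ∏ (suc n) f                      ≡⟨ ∏≡product (suc n) f ⟩
    Π.sum f                          ≈⟨ Π.sum-init-last f ⟩
    Π.sum (f ∘ inject₁) * f (fromℕ n) ≡⟨ ≡.cong (_* f (fromℕ n)) (∏≡product n _) ⟨
    ∏ n (f ∘ inject₁) * f (fromℕ n)  ∎

  ∑L-cong : ∀ {a} {A : Set a} (xs : List A) {f g : A → Carrier} →
            (∀ x → f x ≈ g x) → ∑L xs f ≈ ∑L xs g
  ∑L-cong []       f≈g = ≈-refl
  ∑L-cong (x List.∷ xs) f≈g = +-cong (f≈g x) (∑L-cong xs f≈g)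

  ∑L-zero : ∀ {a} {A : Set a} (xs : List A) {f : A → Carrier} → (∀ x → f x ≈ 0#) → ∑L xs f ≈ 0#
  ∑L-zero []       f≈0 = ≈-refl
  ∑L-zero (x List.∷ xs) f≈0 = trans (+-cong (f≈0 x) (∑L-zero xs f≈0)) (+-identityˡ 0#)

  *-distribˡ-∑L : ∀ {a} {A : Set a} (xs : List A) y (f : A → Carrier) →
                  y * ∑L xs f ≈ ∑L xs (λ x → y * f x)
  *-distribˡ-∑L []       y f = zeroʳ y
  *-distribˡ-∑L (x List.∷ xs) y f = trans (distribˡ y _ _) (+-cong ≈-refl (*-distribˡ-∑L xs y f))

  ∑L-++ : ∀ {a} {A : Set a} (xs ys : List A) (f : A → Carrier) → ∑L (xs ++ ys) f ≈ ∑L xs f + ∑L ys f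
  ∑L-++ []       ys f = sym (+-identityˡ _)
  ∑L-++ (x List.∷ xs) ys f = trans (+-cong ≈-refl (∑L-++ xs ys f)) (sym (+-assoc _ _ _))

  ∑L-map : ∀ {a b} {A : Set a} {B : Set b} (h : A → B) (xs : List A) (f : B → Carrier) →
           ∑L (map h xs) f ≡ ∑L xs (f ∘ h)
  ∑L-map h []       f = refl
  ∑L-map h (x List.∷ xs) f = ≡.cong (f (h x) +_) (∑L-map h xs f)

  ∑L-concatMap : ∀ {a b} {A : Set a} {B : Set b} (h : A → List B) (xs : List A) (f : B → Carrier) →
                 ∑L (concatMap h xs) f ≈ ∑L xs (λ x → ∑L (h x) f)
  ∑L-concatMap h []       f = ≈-refl
  ∑L-concatMap h (x List.∷ xs) f = trans (∑L-++ (h x) _ f) (+-cong ≈-refl (∑L-concatMap h xs f))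

  ∑L-tabulate : ∀ n {b} {B : Set b} (h : Fin n → B) (f : B → Carrier) →
                ∑L (List.tabulate h) f ≡ ∑ n (f ∘ h)
  ∑L-tabulate zero    h f = refl
  ∑L-tabulate (suc n) h f = ≡.cong (f (h zero) +_) (∑L-tabulate n (h ∘ suc) f)

  ∑L-allFuns-cons : ∀ n m (G : (Fin (suc n) → Fin m) → Carrier) →
                    ∑L (allFuns (suc n) m) G ≈ ∑ m (λ a → ∑L (allFuns n m) (G ∘ cons a))
  ∑L-allFuns-cons n m G = begin
    ∑L (allFuns (suc n) m) G
      ≈⟨ ∑L-concatMap (λ a → map (cons a) (allFuns n m)) (List.allFin m) G ⟩
    ∑L (List.allFin m) (λ a → ∑L (map (cons a) (allFuns n m)) G)
      ≡⟨ ∑L-tabulate m (λ a → a) _ ⟩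
    ∑ m (λ a → ∑L (map (cons a) (allFuns n m)) G)
      ≡⟨ ∑-cong≡ m (λ a → ∑L-map (cons a) (allFuns n m) G) ⟩
    ∑ m (λ a → ∑L (allFuns n m) (G ∘ cons a)) ∎

  ∑L-allFuns-snoc : ∀ n m (G : (Fin (suc n) → Fin m) → Carrier) →
                    ∑L (allFuns (suc n) m) G ≈ ∑ m (λ a → ∑L (allFuns n m) (λ f → G (snoc f a)))
  ∑L-allFuns-snoc zero    m G = ∑L-allFuns-cons zero m G
  ∑L-allFuns-snoc (suc n) m G = begin
    ∑L (allFuns (suc (suc n)) m) G
      ≈⟨ ∑L-allFuns-cons (suc n) m G ⟩
    ∑ m (λ b → ∑L (allFuns (suc n) m) (G ∘ cons b))
      ≈⟨ ∑-cong m (λ b → ∑L-allFuns-snoc n m (G ∘ cons b)) ⟩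
    ∑ m (λ b → ∑ m (λ a → ∑L (allFuns n m) (λ f → G (cons b (snoc f a)))))
      ≈⟨ ∑-comm m m _ ⟩
    ∑ m (λ a → ∑ m (λ b → ∑L (allFuns n m) (λ f → G (cons b (snoc f a)))))
      ≈⟨ ∑-cong m (λ a → ∑L-allFuns-cons n m (λ f → G (snoc f a))) ⟨
    ∑ m (λ a → ∑L (allFuns (suc n) m) (λ f → G (snoc f a))) ∎

  if-cong : ∀ {b b′ x y} → T b ⇔ T b′ → (T b → x ≈ y) →
            (if b then x else 0#) ≈ (if b′ then y else 0#)
  if-cong {true}  {true}  b⇔b′ x≈y = x≈y _
  if-cong {true}  {false} b⇔b′ x≈y = ⊥-elim (Equivalence.to b⇔b′ _)
  if-cong {false} {true}  b⇔b′ x≈y = ⊥-elim (Equivalence.from b⇔b′ _)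
  if-cong {false} {false} b⇔b′ x≈y = ≈-refl

  if-false : ∀ {b x} → ¬ T b → (if b then x else 0#) ≈ 0#
  if-false {true}  ¬b = ⊥-elim (¬b _)
  if-false {false} ¬b = ≈-refl

  *-if : ∀ b x y → x * (if b then y else 0#) ≈ (if b then x * y else 0#)
  *-if true  x y = ≈-refl
  *-if false x y = zeroʳ x

  ⁻¹-unique : ∀ {x y} → ¬ x ≈ 0# → x * y ≈ 1# → y ≈ x ⁻¹
  ⁻¹-unique {x} {y} x≉0 xy≈1 = begin
    y                ≈⟨ trans (*-cong ≈-refl (⁻¹-inverse x x≉0)) (*-identityʳ y) ⟨
    y * (x * x ⁻¹)   ≈⟨ *-assoc _ _ _ ⟨
    (y * x) * x ⁻¹   ≈⟨ *-cong (trans (*-comm y x) xy≈1) ≈-refl ⟩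
    1# * x ⁻¹        ≈⟨ *-identityˡ _ ⟩
    x ⁻¹             ∎

  ratio-scale : ∀ {ε x y X Y} → ε * ε ≈ 1# → ¬ y ≈ 0# → X ≈ ε * x → Y ≈ ε * y → X * Y ⁻¹ ≈ x * y ⁻¹
  ratio-scale {ε} {x} {y} {X} {Y} εε≈1 y≉0 X≈εx Y≈εy = begin
    X * Y ⁻¹                 ≈⟨ *-cong X≈εx (sym εy⁻¹≈Y⁻¹) ⟩
    (ε * x) * (ε * y ⁻¹)     ≈⟨ interchange ε x ε (y ⁻¹) ⟩
    (ε * ε) * (x * y ⁻¹)     ≈⟨ trans (*-cong εε≈1 ≈-refl) (*-identityˡ _) ⟩
    x * y ⁻¹                 ∎
    where
    εε-cancel : ∀ z → z ≈ ε * (ε * z)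
    εε-cancel z = trans (sym (*-identityˡ z)) (trans (*-cong (sym εε≈1) ≈-refl) (*-assoc ε ε z))
    Y≉0 : ¬ Y ≈ 0#
    Y≉0 Y≈0 = y≉0 (trans (εε-cancel y) (trans (*-cong ≈-refl (trans (sym Y≈εy) Y≈0)) (zeroʳ ε)))
    εy⁻¹≈Y⁻¹ : ε * y ⁻¹ ≈ Y ⁻¹
    εy⁻¹≈Y⁻¹ = ⁻¹-unique Y≉0 (begin
      Y * (ε * y ⁻¹)          ≈⟨ *-cong Y≈εy ≈-refl ⟩
      (ε * y) * (ε * y ⁻¹)    ≈⟨ interchange ε y ε (y ⁻¹) ⟩
      (ε * ε) * (y * y ⁻¹)    ≈⟨ *-cong εε≈1 (⁻¹-inverse y y≉0) ⟩
      1# * 1#                 ≈⟨ *-identityˡ 1# ⟩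
      1#                      ∎)

  -- Signs

  sign′ : ∀ {k D} → (Fin k → Fin D) → Carrier
  sign′ f = negOnePow (inversions′ f)

  negOnePow-+ : ∀ m n → negOnePow (m +ℕ n) ≈ negOnePow m * negOnePow n
  negOnePow-+ zero    n = sym (*-identityˡ _)
  negOnePow-+ (suc m) n = trans (-‿cong (negOnePow-+ m n)) (-‿distribˡ-* _ _)

  negOnePow-square : ∀ n → negOnePow n * negOnePow n ≈ 1#
  negOnePow-square zero    = *-identityˡ 1#
  negOnePow-square (suc n) = begin
    - negOnePow n * - negOnePow n   ≈⟨ -‿distribˡ-* _ _ ⟨
    - (negOnePow n * - negOnePow n) ≈⟨ -‿cong (-‿distribʳ-* _ _) ⟨
    - - (negOnePow n * negOnePow n) ≈⟨ ⁻¹-involutive _ ⟩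
    negOnePow n * negOnePow n       ≈⟨ negOnePow-square n ⟩
    1#                              ∎

  negOnePow-cancel : ∀ n {x} → negOnePow n * x ≈ 0# → x ≈ 0#
  negOnePow-cancel n {x} εx≈0 = begin
    x                                  ≈⟨ trans (*-cong (negOnePow-square n) ≈-refl) (*-identityˡ x) ⟨
    (negOnePow n * negOnePow n) * x    ≈⟨ *-assoc _ _ _ ⟩
    negOnePow n * (negOnePow n * x)    ≈⟨ trans (*-cong ≈-refl εx≈0) (zeroʳ _) ⟩
    0#                                 ∎

  sign′-cons : ∀ {k D} (σ : Fin (suc k) → Fin D) →
               sign′ σ ≈ negOnePow (countBelow (σ zero) (σ ∘ suc)) * sign′ (σ ∘ suc)
  sign′-cons σ = trans (reflexive (≡.cong negOnePow (inversions′-cons σ)))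
                       (negOnePow-+ (countBelow (σ zero) (σ ∘ suc)) (inversions′ (σ ∘ suc)))

  negOnePow-[<]-flip : ∀ {D} {x y : Fin D} → x ≢ y → negOnePow [ x < y ] ≈ - negOnePow [ y < x ]
  negOnePow-[<]-flip {x = x} {y} x≢y with Finₚ.<-cmp x y
  ... | tri< x<y _ y≮x rewrite ltB-true x<y | ltB-false y≮x = ≈-refl
  ... | tri> x≮y _ y<x rewrite ltB-false x≮y | ltB-true y<x = sym (⁻¹-involutive 1#)
  ... | tri≈ _ x≡y _ = ⊥-elim (x≢y x≡y)

  sign′-moveToFront : ∀ {k D} {s : Fin (suc k) → Fin D} → Injective≡ s → ∀ r →
    sign′ s * negOnePow (toℕ r) ≈ negOnePow (countBelow (s r) (removeAt s r)) * sign′ (removeAt s r)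
  sign′-moveToFront {s = s} s-inj zero = trans (*-identityʳ _) (sign′-cons s)
  sign′-moveToFront {suc k} {s = s} s-inj (suc r) = begin
    sign′ s * - ρ
      ≈⟨ *-cong (sign′-cons s) ≈-refl ⟩
    (negOnePow (countBelow s₀ t) * sign′ t) * - ρ
      ≈⟨ *-cong (*-cong (trans (reflexive (≡.cong negOnePow (sumℕ-remove k (λ b → [ t b < s₀ ]) r)))
                                (negOnePow-+ [ t r < s₀ ] _)) ≈-refl) ≈-refl ⟩
    ((a * A) * sign′ t) * - ρ
      ≈⟨ -‿distribʳ-* _ _ ⟨
    - (((a * A) * sign′ t) * ρ)
      ≈⟨ -‿cong (*-assoc _ _ _) ⟩
    - ((a * A) * (sign′ t * ρ))
      ≈⟨ -‿cong (*-cong ≈-refl (sign′-moveToFront (removeAt-injective zero s-inj) r)) ⟩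
    - ((a * A) * (B * C))
      ≈⟨ -‿cong (solve 4 (λ a A B C → (a :* A) :* (B :* C) := a :* (B :* (A :* C))) ≈-refl a A B C) ⟩
    - (a * (B * (A * C)))
      ≈⟨ -‿distribˡ-* _ _ ⟩
    - a * (B * (A * C))
      ≈⟨ *-cong (negOnePow-[<]-flip s₀≢tr) ≈-refl ⟨
    a′ * (B * (A * C))
      ≈⟨ *-assoc _ _ _ ⟨
    (a′ * B) * (A * C)
      ≈⟨ *-cong (negOnePow-+ [ s₀ < t r ] _) (sign′-cons (removeAt s (suc r))) ⟨
    negOnePow (countBelow (t r) (removeAt s (suc r))) * sign′ (removeAt s (suc r)) ∎
    where
    s₀ = s zero
    t = s ∘ suc
    ρ = negOnePow (toℕ r)
    a = negOnePow [ t r < s₀ ]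
    a′ = negOnePow [ s₀ < t r ]
    A = negOnePow (countBelow s₀ (removeAt t r))
    B = negOnePow (countBelow (t r) (removeAt t r))
    C = sign′ (removeAt t r)
    s₀≢tr : s₀ ≢ t r
    s₀≢tr = (λ ()) ∘ s-inj

  sign′-snoc : ∀ {k D} (f : Fin k → Fin D) a → Injective≡ (snoc f a) →
               sign′ (snoc f a) ≈ negOnePow k * (negOnePow (countBelow a f) * sign′ f)
  sign′-snoc {k} f a σ-inj = begin
    sign′ σ
      ≈⟨ trans (*-cong ≈-refl (negOnePow-square k)) (*-identityʳ _) ⟨
    sign′ σ * (negOnePow k * negOnePow k)
      ≈⟨ *-assoc _ _ _ ⟨
    (sign′ σ * negOnePow k) * negOnePow k
      ≡⟨ ≡.cong (λ n → (sign′ σ * negOnePow n) * negOnePow k) (≡.sym (Finₚ.toℕ-fromℕ k)) ⟩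
    (sign′ σ * negOnePow (toℕ (fromℕ k))) * negOnePow k
      ≈⟨ *-cong (sign′-moveToFront σ-inj (fromℕ k)) ≈-refl ⟩
    (negOnePow (countBelow (σ (fromℕ k)) (removeAt σ (fromℕ k))) * sign′ (removeAt σ (fromℕ k))) * negOnePow k
      ≡⟨ ≡.cong₂ (λ m n → (negOnePow m * negOnePow n) * negOnePow k)
           (≡.trans (≡.cong (λ x → countBelow x (removeAt σ (fromℕ k))) (snoc-last f a)) (countBelow-cong a (snoc-punchIn f a)))
           (inversions′-cong (snoc-punchIn f a)) ⟩
    (negOnePow (countBelow a f) * sign′ f) * negOnePow k
      ≈⟨ *-comm _ _ ⟩
    negOnePow k * (negOnePow (countBelow a f) * sign′ f) ∎
    where σ = snoc f a

  -- Determinants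

  Matrix : ℕ → Set c
  Matrix n = Fin n → Fin n → Carrier

  -- det (suc n) M unfolds to the expansion along row 0 into these minors.
  minor : ∀ {n} → Matrix (suc n) → Fin (suc n) → Matrix n
  minor M j r c = M (suc r) (punchIn j c)

  det-cong : ∀ n {M N : Matrix n} → (∀ r c → M r c ≈ N r c) → det n M ≈ det n N
  det-cong zero    M≈N = ≈-refl
  det-cong (suc n) M≈N = ∑-cong (suc n) λ j →
    *-cong (≈-refl {negOnePow (toℕ j)}) (*-cong (M≈N zero j) (det-cong n (λ r c → M≈N (suc r) (punchIn j c))))

  det-cong≡ : ∀ n {M N : Matrix n} → (∀ r c → M r c ≡ N r c) → det n M ≡ det n N
  det-cong≡ zero    M≡N = refl
  det-cong≡ (suc n) M≡N = ∑-cong≡ (suc n) λ j → ≡.cong₂ (λ x y → negOnePow (toℕ j) * (x * y))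
    (M≡N zero j) (det-cong≡ n (λ r c → M≡N (suc r) (punchIn j c)))

  det-minors-cong : ∀ n (M : Matrix (suc n)) {d : Fin (suc n) → Carrier} → (∀ j → det n (minor M j) ≈ d j) →
                    det (suc n) M ≈ ∑ (suc n) (λ j → negOnePow (toℕ j) * (M zero j * d j))
  det-minors-cong n M minor≈d = ∑-cong (suc n) λ j →
    *-cong (≈-refl {negOnePow (toℕ j)}) (*-cong (≈-refl {M zero j}) (minor≈d j))

  *-det-suc : ∀ n x (M : Matrix (suc n)) →
    x * det (suc n) M ≈ ∑ (suc n) (λ j → negOnePow (toℕ j) * (M zero j * (x * det n (minor M j))))
  *-det-suc n x M = trans (*-distribˡ-∑ (suc n) x (λ j → negOnePow (toℕ j) * (M zero j * det n (minor M j))))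
    (∑-cong (suc n) λ j → trans (x∙yz≈y∙xz x (negOnePow (toℕ j)) _)
                                (*-cong ≈-refl (x∙yz≈y∙xz x (M zero j) (det n (minor M j)))))

  ∑-neg : ∀ n (f : Fin n → Carrier) → ∑ n (λ i → - f i) ≈ - ∑ n f
  ∑-neg zero    f = sym -0#≈0#
  ∑-neg (suc n) f = trans (+-cong ≈-refl (∑-neg n (f ∘ suc))) (⁻¹-∙-comm (f zero) _)

  -- The diagonal hypothesis is not implied by the other in characteristic 2.
  ∑∑-antisymmetric : ∀ n (P : Fin n → Fin n → Carrier) → (∀ j → P j j ≈ 0#) →
                     (∀ j k → j ≢ k → P j k + P k j ≈ 0#) → ∑ n (λ j → ∑ n (P j)) ≈ 0#
  ∑∑-antisymmetric zero    P diag anti = ≈-refl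
  ∑∑-antisymmetric (suc n) P diag anti = begin
    (P₀₀ + ∑ n (λ k → P zero (suc k))) + ∑ n (λ j → P (suc j) zero + ∑ n (λ k → P (suc j) (suc k)))
      ≈⟨ +-cong ≈-refl (∑-distrib-+ n _ _) ⟩
    (P₀₀ + ∑ n (λ k → P zero (suc k))) + (∑ n (λ j → P (suc j) zero) + inner)
      ≈⟨ solve 4 (λ a b c d → (a :+ b) :+ (c :+ d) := a :+ (b :+ c) :+ d) ≈-refl P₀₀ _ _ inner ⟩
    P₀₀ + (∑ n (λ k → P zero (suc k)) + ∑ n (λ j → P (suc j) zero)) + inner
      ≈⟨ +-cong (+-cong (diag zero) (trans (sym (∑-distrib-+ n (P zero ∘ suc) (λ k → P (suc k) zero)))
           (∑-zero n (λ k → anti zero (suc k) (λ ()))))) (∑∑-antisymmetric n (λ j k → P (suc j) (suc k))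
             (diag ∘ suc) (λ j k j≢k → anti (suc j) (suc k) (j≢k ∘ Finₚ.suc-injective))) ⟩
    0# + 0# + 0#
      ≈⟨ trans (+-identityʳ _) (+-identityʳ _) ⟩
    0# ∎
    where
    P₀₀ = P zero zero
    inner = ∑ n (λ j → ∑ n (λ k → P (suc j) (suc k)))

  module TwoRows {n : ℕ} (R : Fin n → Fin (suc (suc n)) → Carrier) where

    Row : Set c
    Row = Fin (suc (suc n)) → Carrier

    -- the term of det (a ∷ b ∷ R) using column j of a and column k = punchIn j l of b
    term : Row → Row → (j k : Fin (suc (suc n))) → Fin (suc n) → Carrier
    term a b j k l = (negOnePow (toℕ j) * negOnePow (toℕ l)) *
                     ((a j * b k) * det n (λ r c → R r (punchIn j (punchIn l c))))

    pair : Row → Row → Fin (suc (suc n)) → Fin (suc (suc n)) → Carrier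
    pair a b j k with j Fin.≟ k
    ... | yes _   = 0#
    ... | no  j≢k = term a b j k (punchOut j≢k)

    pair-diag : ∀ a b j → pair a b j j ≈ 0#
    pair-diag a b j with j Fin.≟ j
    ... | yes _   = ≈-refl
    ... | no  j≢j = ⊥-elim (j≢j refl)

    pair-≢ : ∀ a b {j k} (j≢k : j ≢ k) → pair a b j k ≡ term a b j k (punchOut j≢k)
    pair-≢ a b {j} {k} j≢k with j Fin.≟ k
    ... | yes j≡k  = ⊥-elim (j≢k j≡k)
    ... | no  j≢k′ = ≡.cong (term a b j k) (Finₚ.punchOut-cong j refl)

    det-pairs : ∀ a b → det (suc (suc n)) (a ∷ b ∷ R) ≈ ∑ (suc (suc n)) (λ j → ∑ (suc (suc n)) (pair a b j))
    det-pairs a b = ∑-cong (suc (suc n)) λ j → begin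
      negOnePow (toℕ j) * (a j * ∑ (suc n) (E j))
        ≈⟨ trans (*-cong ≈-refl (*-distribˡ-∑ (suc n) (a j) (E j)))
                 (*-distribˡ-∑ (suc n) (negOnePow (toℕ j)) (λ l → a j * E j l)) ⟩
      ∑ (suc n) (λ l → negOnePow (toℕ j) * (a j * (negOnePow (toℕ l) * (b (punchIn j l) * D j l))))
        ≈⟨ ∑-cong (suc n) (λ l → solve 5 (λ εj εl x y d → εj :* (x :* (εl :* (y :* d))) := (εj :* εl) :* ((x :* y) :* d))
                                       ≈-refl (negOnePow (toℕ j)) (negOnePow (toℕ l)) (a j) (b (punchIn j l)) (D j l)) ⟩
      ∑ (suc n) (λ l → term a b j (punchIn j l) l)
        ≈⟨ ∑-cong (suc n) (λ l → reflexive (≡.trans (pair-≢ a b (punchInᵢ≢i j l ∘ ≡.sym))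
                                                     (≡.cong (term a b j (punchIn j l)) (Finₚ.punchOut-punchIn j)))) ⟨
      ∑ (suc n) (λ l → pair a b j (punchIn j l))
        ≈⟨ trans (+-cong (pair-diag a b j) ≈-refl) (+-identityˡ _) ⟨
      pair a b j j + ∑ (suc n) (removeAt (pair a b j) j)
        ≈⟨ ∑-remove (suc n) (pair a b j) j ⟨
      ∑ (suc (suc n)) (pair a b j) ∎
      where
      D : Fin (suc (suc n)) → Fin (suc n) → Carrier
      D j l = det n (λ r c → R r (punchIn j (punchIn l c)))
      E : Fin (suc (suc n)) → Fin (suc n) → Carrier
      E j l = negOnePow (toℕ l) * (b (punchIn j l) * D j l)

    sign-swap-< : ∀ {j k : Fin (suc (suc n))} (j≢k : j ≢ k) (k≢j : k ≢ j) → toℕ j ℕ.< toℕ k →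
      negOnePow (toℕ k) * negOnePow (toℕ (punchOut k≢j)) ≈ - (negOnePow (toℕ j) * negOnePow (toℕ (punchOut j≢k)))
    sign-swap-< {j} {k} j≢k k≢j j<k = begin
      negOnePow (toℕ k) * negOnePow (toℕ (punchOut k≢j))
        ≡⟨ ≡.cong₂ (λ x y → negOnePow x * negOnePow y) (≡.sym (toℕ-punchOut-< j≢k j<k)) (toℕ-punchOut-> k≢j j<k) ⟩
      - negOnePow (toℕ (punchOut j≢k)) * negOnePow (toℕ j)
        ≈⟨ -‿distribˡ-* _ _ ⟨
      - (negOnePow (toℕ (punchOut j≢k)) * negOnePow (toℕ j))
        ≈⟨ -‿cong (*-comm _ _) ⟩
      - (negOnePow (toℕ j) * negOnePow (toℕ (punchOut j≢k))) ∎

    sign-swap : ∀ {j k : Fin (suc (suc n))} (j≢k : j ≢ k) (k≢j : k ≢ j) →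
      negOnePow (toℕ k) * negOnePow (toℕ (punchOut k≢j)) ≈ - (negOnePow (toℕ j) * negOnePow (toℕ (punchOut j≢k)))
    sign-swap {j} {k} j≢k k≢j with Finₚ.<-cmp j k
    ... | tri< j<k _ _ = sign-swap-< j≢k k≢j j<k
    ... | tri≈ _ j≡k _ = ⊥-elim (j≢k j≡k)
    ... | tri> _ _ k<j = trans (sym (⁻¹-involutive _)) (-‿cong (sym (sign-swap-< k≢j j≢k k<j)))

    pair-swap : ∀ a b j k → pair b a k j ≈ - pair a b j k
    pair-swap a b j k with j Fin.≟ k
    ... | yes refl = trans (pair-diag b a j) (sym -0#≈0#)
    ... | no  j≢k  = begin
      pair b a k j
        ≡⟨ pair-≢ b a k≢j ⟩
      s′ * ((b k * a j) * det n (λ r c → R r (punchIn k (punchIn (punchOut k≢j) c))))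
        ≈⟨ *-cong (sign-swap j≢k k≢j) (*-cong (*-comm _ _) (reflexive (det-cong≡ n λ r c →
             ≡.cong (R r) (≡.sym (punchIn-punchOut-comm j≢k k≢j c))))) ⟩
      - s * ((a j * b k) * det n (λ r c → R r (punchIn j (punchIn (punchOut j≢k) c))))
        ≈⟨ -‿distribˡ-* _ _ ⟨
      - term a b j k (punchOut j≢k) ∎
      where
      k≢j : k ≢ j
      k≢j = j≢k ∘ ≡.sym
      s  = negOnePow (toℕ j) * negOnePow (toℕ (punchOut j≢k))
      s′ = negOnePow (toℕ k) * negOnePow (toℕ (punchOut k≢j))

  det-swap₀₁ : ∀ {n} (a b : Fin (suc (suc n)) → Carrier) R →
               det (suc (suc n)) (b ∷ a ∷ R) ≈ - det (suc (suc n)) (a ∷ b ∷ R)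
  det-swap₀₁ {n} a b R = begin
    det N (b ∷ a ∷ R)                               ≈⟨ det-pairs b a ⟩
    ∑ N (λ j → ∑ N (λ k → pair b a j k))            ≈⟨ ∑-cong N (λ j → ∑-cong N (λ k → pair-swap a b k j)) ⟩
    ∑ N (λ j → ∑ N (λ k → - pair a b k j))          ≈⟨ ∑-cong N (λ j → ∑-neg N (λ k → pair a b k j)) ⟩
    ∑ N (λ j → - ∑ N (λ k → pair a b k j))          ≈⟨ ∑-neg N (λ j → ∑ N (λ k → pair a b k j)) ⟩
    - ∑ N (λ j → ∑ N (λ k → pair a b k j))          ≈⟨ -‿cong (∑-comm N N (λ j k → pair a b k j)) ⟩
    - ∑ N (λ k → ∑ N (pair a b k))                  ≈⟨ -‿cong (det-pairs a b) ⟨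
    - det N (a ∷ b ∷ R)                             ∎
    where
    N = suc (suc n)
    open TwoRows R

  det-repeated₀₁ : ∀ {n} (a : Fin (suc (suc n)) → Carrier) R → det (suc (suc n)) (a ∷ a ∷ R) ≈ 0#
  det-repeated₀₁ {n} a R = trans (det-pairs a a) (∑∑-antisymmetric (suc (suc n)) (pair a a)
    (pair-diag a a) (λ j k _ → trans (+-cong ≈-refl (pair-swap a a j k)) (-‿inverseʳ (pair a a j k))))
    where open TwoRows R

  det-moveToFront : ∀ n (M : Matrix (suc n)) r →
                    det (suc n) M ≈ negOnePow (toℕ r) * det (suc n) (M r ∷ removeAt M r)
  det-moveToFront n       M zero    = sym (*-identityˡ _)
  det-moveToFront (suc n) M (suc r) = begin
    det (suc (suc n)) M
      ≈⟨ det-minors-cong (suc n) M (λ j → det-moveToFront n (minor M j) r) ⟩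
    ∑ (suc (suc n)) (λ j → negOnePow (toℕ j) * (M zero j * (ρ * det (suc n) (minor M′ j))))
      ≈⟨ *-det-suc (suc n) ρ M′ ⟨
    ρ * det (suc (suc n)) (M zero ∷ M (suc r) ∷ removeAt (M ∘ suc) r)
      ≈⟨ *-cong ≈-refl (det-swap₀₁ (M (suc r)) (M zero) (removeAt (M ∘ suc) r)) ⟩
    ρ * - det (suc (suc n)) (M (suc r) ∷ removeAt M (suc r))
      ≈⟨ trans (sym (-‿distribʳ-* _ _)) (-‿distribˡ-* _ _) ⟩
    - ρ * det (suc (suc n)) (M (suc r) ∷ removeAt M (suc r)) ∎
    where
    ρ = negOnePow (toℕ r)
    M′ : Matrix (suc (suc n))
    M′ = M zero ∷ M (suc r) ∷ removeAt (M ∘ suc) r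

  det-moveToSecond : ∀ n (a : Fin (suc (suc n)) → Carrier) (R : Fin (suc n) → Fin (suc (suc n)) → Carrier) r →
    det (suc (suc n)) (a ∷ R) ≈ negOnePow (toℕ r) * det (suc (suc n)) (a ∷ R r ∷ removeAt R r)
  det-moveToSecond n a R r = begin
    det (suc (suc n)) (a ∷ R)
      ≈⟨ det-minors-cong (suc n) (a ∷ R) (λ j → det-moveToFront n (minor (a ∷ R) j) r) ⟩
    ∑ (suc (suc n)) (λ j → negOnePow (toℕ j) * (a j * (ρ * det (suc n) (minor M′ j))))
      ≈⟨ *-det-suc (suc n) ρ M′ ⟨
    ρ * det (suc (suc n)) M′ ∎
    where
    ρ = negOnePow (toℕ r)
    M′ : Matrix (suc (suc n))
    M′ = a ∷ R r ∷ removeAt R r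

  det-repeated-rows : ∀ n (M : Matrix n) {p q} → p ≢ q → (∀ c → M p c ≈ M q c) → det n M ≈ 0#
  det-repeated-rows (suc zero)    M {zero} {zero} p≢q Mp≈Mq = ⊥-elim (p≢q refl)
  det-repeated-rows (suc (suc n)) M {p} {q} p≢q Mp≈Mq = begin
    det (suc (suc n)) M
      ≈⟨ det-moveToFront (suc n) M q ⟩
    negOnePow (toℕ q) * det (suc (suc n)) (M q ∷ R)
      ≈⟨ *-cong ≈-refl (det-moveToSecond n (M q) R p′) ⟩
    negOnePow (toℕ q) * (negOnePow (toℕ p′) * det (suc (suc n)) (M q ∷ R p′ ∷ removeAt R p′))
      ≈⟨ *-cong ≈-refl (*-cong ≈-refl (trans (det-cong (suc (suc n)) rows) (det-repeated₀₁ (M q) (removeAt R p′)))) ⟩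
    negOnePow (toℕ q) * (negOnePow (toℕ p′) * 0#)
      ≈⟨ trans (*-cong ≈-refl (zeroʳ _)) (zeroʳ _) ⟩
    0# ∎
    where
    R = removeAt M q
    q≢p : q ≢ p
    q≢p = p≢q ∘ ≡.sym
    p′ = punchOut q≢p
    rows : ∀ r c → (M q ∷ R p′ ∷ removeAt R p′) r c ≈ (M q ∷ M q ∷ removeAt R p′) r c
    rows zero          c = ≈-refl
    rows (suc zero)    c = trans (reflexive (≡.cong (λ x → M x c) (Finₚ.punchIn-punchOut q≢p))) (Mp≈Mq c)
    rows (suc (suc r)) c = ≈-refl

  det-expand-col₀ : ∀ n (M : Matrix (suc n)) → det (suc n) M ≈
    ∑ (suc n) (λ r → negOnePow (toℕ r) * (M r zero * det n (λ a b → M (punchIn r a) (suc b))))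
  det-expand-col₀ zero    M = ≈-refl
  det-expand-col₀ (suc n) M = +-cong ≈-refl (begin
    ∑ (suc n) (λ j → - ε j * (M zero (suc j) * det (suc n) (minor M (suc j))))
      ≈⟨ ∑-cong (suc n) (λ j → *-cong (≈-refl { - ε j})
           (*-cong (≈-refl {M zero (suc j)}) (det-expand-col₀ n (minor M (suc j))))) ⟩
    ∑ (suc n) (λ j → - ε j * (M zero (suc j) * ∑ (suc n) (λ r → ε r * (M (suc r) zero * D r j))))
      ≈⟨ ∑-cong (suc n) (λ j → *-*-distribˡ-∑ (- ε j) (M zero (suc j)) (λ r → ε r * (M (suc r) zero * D r j))) ⟩
    ∑ (suc n) (λ j → ∑ (suc n) (λ r → - ε j * (M zero (suc j) * (ε r * (M (suc r) zero * D r j)))))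
      ≈⟨ ∑-comm (suc n) (suc n) (λ j r → - ε j * (M zero (suc j) * (ε r * (M (suc r) zero * D r j)))) ⟩
    ∑ (suc n) (λ r → ∑ (suc n) (λ j → - ε j * (M zero (suc j) * (ε r * (M (suc r) zero * D r j)))))
      ≈⟨ ∑-cong (suc n) (λ r → ∑-cong (suc n) (λ j → swap (ε j) (ε r) (M zero (suc j)) (M (suc r) zero) (D r j))) ⟩
    ∑ (suc n) (λ r → ∑ (suc n) (λ j → - ε r * (M (suc r) zero * (ε j * (M zero (suc j) * D r j)))))
      ≈⟨ ∑-cong (suc n) (λ r → *-*-distribˡ-∑ (- ε r) (M (suc r) zero) (λ j → ε j * (M zero (suc j) * D r j))) ⟨
    ∑ (suc n) (λ r → - ε r * (M (suc r) zero * ∑ (suc n) (λ j → ε j * (M zero (suc j) * D r j)))) ∎)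
    where
    ε : ∀ {m} → Fin m → Carrier
    ε i = negOnePow (toℕ i)
    D : Fin (suc n) → Fin (suc n) → Carrier
    D r j = det n (λ a b → M (suc (punchIn r a)) (suc (punchIn j b)))
    *-*-distribˡ-∑ : ∀ x y (f : Fin (suc n) → Carrier) → x * (y * ∑ (suc n) f) ≈ ∑ (suc n) (λ i → x * (y * f i))
    *-*-distribˡ-∑ x y f = trans (*-cong ≈-refl (*-distribˡ-∑ (suc n) y f)) (*-distribˡ-∑ (suc n) x (λ i → y * f i))
    swap : ∀ s t x y d → - s * (x * (t * (y * d))) ≈ - t * (y * (s * (x * d)))
    swap s t x y d = begin
      - s * (x * (t * (y * d)))   ≈⟨ -‿distribˡ-* _ _ ⟨
      - (s * (x * (t * (y * d))))
        ≈⟨ -‿cong (solve 5 (λ s t x y d → s :* (x :* (t :* (y :* d))) := t :* (y :* (s :* (x :* d))))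
                    ≈-refl s t x y d) ⟩
      - (t * (y * (s * (x * d)))) ≈⟨ -‿distribˡ-* _ _ ⟩
      - t * (y * (s * (x * d)))   ∎

  det-transpose : ∀ n (M : Matrix n) → det n (λ r c → M c r) ≈ det n M
  det-transpose zero    M = ≈-refl
  det-transpose (suc n) M = trans (det-minors-cong n (λ r c → M c r) (λ j → det-transpose n (λ a b → M (punchIn j a) (suc b))))
                                  (sym (det-expand-col₀ n M))

  cofactorₗ : ∀ n → Matrix (suc n) → Fin (suc n) → Carrier
  cofactorₗ n M r = negOnePow n * (negOnePow (toℕ r) * det n (λ a b → M (punchIn r a) (punchIn (fromℕ n) b)))

  det-expand-lastCol : ∀ n (M : Matrix (suc n)) → det (suc n) M ≈ ∑ (suc n) (λ r → cofactorₗ n M r * M r (fromℕ n))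
  det-expand-lastCol n M = begin
    det (suc n) M
      ≈⟨ det-transpose (suc n) M ⟨
    det (suc n) Mᵀ
      ≈⟨ det-moveToFront n Mᵀ L ⟩
    negOnePow (toℕ L) * det (suc n) (Mᵀ L ∷ removeAt Mᵀ L)
      ≈⟨ *-cong (reflexive (≡.cong negOnePow (Finₚ.toℕ-fromℕ n)))
                (det-minors-cong n (Mᵀ L ∷ removeAt Mᵀ L) (λ r → det-transpose n (λ a b → M (punchIn r a) (punchIn L b)))) ⟩
    negOnePow n * ∑ (suc n) (λ r → negOnePow (toℕ r) * (M r L * d r))
      ≈⟨ *-distribˡ-∑ (suc n) (negOnePow n) (λ r → negOnePow (toℕ r) * (M r L * d r)) ⟩
    ∑ (suc n) (λ r → negOnePow n * (negOnePow (toℕ r) * (M r L * d r)))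
      ≈⟨ ∑-cong (suc n) (λ r → solve 4 (λ s e x d → s :* (e :* (x :* d)) := (s :* (e :* d)) :* x)
                                     ≈-refl (negOnePow n) (negOnePow (toℕ r)) (M r L) (d r)) ⟩
    ∑ (suc n) (λ r → cofactorₗ n M r * M r L) ∎
    where
    L = fromℕ n
    Mᵀ : Matrix (suc n)
    Mᵀ r c = M c r
    d : Fin (suc n) → Carrier
    d r = det n (λ a b → M (punchIn r a) (punchIn L b))

  cofactorsₗ-annihilate : ∀ n (M : Matrix (suc n)) → det (suc n) M ≈ 0# →
                          ∀ c → ∑ (suc n) (λ r → cofactorₗ n M r * M r c) ≈ 0#
  cofactorsₗ-annihilate n M det≈0 c = begin
    ∑ (suc n) (λ r → cofactorₗ n M r * M r c)
      ≡⟨ ∑-cong≡ (suc n) (λ r → ≡.cong₂ _*_ (same-cofactor r) (≡.sym (updateAt-updates L {f = λ _ → M r c} (M r)))) ⟩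
    ∑ (suc n) (λ r → cofactorₗ n N r * N r L)
      ≈⟨ det-expand-lastCol n N ⟨
    det (suc n) N
      ≈⟨ det-N ⟩
    0# ∎
    where
    L = fromℕ n
    N : Matrix (suc n)
    N a = updateAt (M a) L (λ _ → M a c)
    same-cofactor : ∀ r → cofactorₗ n M r ≡ cofactorₗ n N r
    same-cofactor r = ≡.cong (λ D → negOnePow n * (negOnePow (toℕ r) * D)) (det-cong≡ n λ a b →
      ≡.sym (updateAt-minimal (punchIn L b) L (M (punchIn r a)) (punchInᵢ≢i L b)))
    det-N : det (suc n) N ≈ 0#
    det-N with c Fin.≟ L
    ... | yes c≡L = trans (reflexive (det-cong≡ (suc n) λ a →
                      updateAt-id-local L {f = λ _ → M a c} (M a) (≡.cong (M a) c≡L))) det≈0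
    ... | no  c≢L = trans (sym (det-transpose (suc n) N)) (det-repeated-rows (suc n) (λ r a → N a r) c≢L λ b →
            reflexive (≡.trans (updateAt-minimal c L {f = λ _ → M b c} (M b) c≢L)
                               (≡.sym (updateAt-updates L {f = λ _ → M b c} (M b)))))

  *-det-suc-cong : ∀ n x y (M N : Matrix (suc n)) → (∀ j → M zero j ≈ N zero j) →
                   (∀ j → x * det n (minor M j) ≈ y * det n (minor N j)) → x * det (suc n) M ≈ y * det (suc n) N
  *-det-suc-cong n x y M N row₀ minors = begin
    x * det (suc n) M
      ≈⟨ *-det-suc n x M ⟩
    ∑ (suc n) (λ j → negOnePow (toℕ j) * (M zero j * (x * det n (minor M j))))
      ≈⟨ ∑-cong (suc n) (λ j → *-cong (≈-refl {negOnePow (toℕ j)}) (*-cong (row₀ j) (minors j))) ⟩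
    ∑ (suc n) (λ j → negOnePow (toℕ j) * (N zero j * (y * det n (minor N j))))
      ≈⟨ *-det-suc n y N ⟨
    y * det (suc n) N ∎

  sign′-*-det-↭ : ∀ k {D} (w : Fin D → Fin k → Carrier) {σ s : Fin k → Fin D} → σ ↭ s →
                  sign′ σ * det k (w ∘ σ) ≈ sign′ s * det k (w ∘ s)
  sign′-*-det-↭ zero    w σ↭s = ≈-refl
  sign′-*-det-↭ (suc k) w {σ} {s} σ↭s = begin
    sign′ σ * det (suc k) (w ∘ σ)
      ≈⟨ trans (*-cong (sign′-cons σ) ≈-refl) (*-assoc _ _ _) ⟩
    negOnePow (countBelow (σ zero) σ′) * (sign′ σ′ * det (suc k) (w ∘ σ))
      ≈⟨ *-cong (reflexive (≡.cong negOnePow same-count))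
                (*-det-suc-cong k (sign′ σ′) (sign′ s′) (w ∘ σ) (w (s r) ∷ w ∘ s′)
                   (λ j → reflexive (≡.cong (λ x → w x j) σ₀≡sr))
                   (λ j → sign′-*-det-↭ k (λ x c → w x (punchIn j c)) σ′↭s′)) ⟩
    negOnePow (countBelow (s r) s′) * (sign′ s′ * det (suc k) (w (s r) ∷ w ∘ s′))
      ≈⟨ trans (*-cong (sign′-moveToFront (injectiveʳ σ↭s) r) ≈-refl) (*-assoc _ _ _) ⟨
    (sign′ s * negOnePow (toℕ r)) * det (suc k) (w (s r) ∷ w ∘ s′)
      ≈⟨ trans (*-cong ≈-refl (det-moveToFront k (w ∘ s) r)) (sym (*-assoc _ _ _)) ⟨
    sign′ s * det (suc k) (w ∘ s) ∎
    where
    r = proj₁ (toʳ σ↭s zero)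
    σ₀≡sr = proj₂ (toʳ σ↭s zero)
    σ′ = σ ∘ suc
    s′ = removeAt s r
    σ′↭s′ : σ′ ↭ s′
    σ′↭s′ = ↭-removeAt σ↭s σ₀≡sr
    same-count : countBelow (σ zero) σ′ ≡ countBelow (s r) s′
    same-count = ≡.trans (≡.cong (λ x → countBelow x σ′) σ₀≡sr) (countBelow-↭ (s r) σ′↭s′)

  det-↭ : ∀ k {D} (w : Fin D → Fin k → Carrier) {σ s : Fin k → Fin D} → σ ↭ s →
          det k (w ∘ σ) ≈ (sign′ σ * sign′ s) * det k (w ∘ s)
  det-↭ k w {σ} {s} σ↭s = begin
    det k (w ∘ σ)                           ≈⟨ trans (*-cong (negOnePow-square (inversions′ σ)) ≈-refl) (*-identityˡ _) ⟨
    (sign′ σ * sign′ σ) * det k (w ∘ σ)     ≈⟨ trans (*-assoc _ _ _) (*-cong ≈-refl (sign′-*-det-↭ k w σ↭s)) ⟩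
    sign′ σ * (sign′ s * det k (w ∘ s))     ≈⟨ *-assoc _ _ _ ⟨
    (sign′ σ * sign′ s) * det k (w ∘ s)     ∎

module Simplex {c ℓ} (F : Field c ℓ) {D : ℕ} (v : FieldDefs.Vertices F D) where

  open Field F hiding (zero) renaming (refl to ≈-refl)
  open FieldDefs F
  open LinearAlgebra F
  open import Algebra.Properties.CommutativeSemigroup *-commutativeSemigroup using (interchange)
  open import Algebra.Solver.Ring.NaturalCoefficients.Default commutativeSemiring
    using (solve; _:*_; _:=_)
  open _↭_
  open import Relation.Binary.Reasoning.Setoid setoid

  Yhat-cong : ∀ j (p : j ≤ D) {s t : Fin j → Fin D} → s ≗ t → ∀ r c → Yhat v j p s r c ≡ Yhat v j p t r c
  Yhat-cong (suc j) p s≗t r zero    = refl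
  Yhat-cong (suc j) p s≗t r (suc c) = ≡.cong (λ x → xhat v x (inject≤ c (ℕₚ.≤-trans (ℕₚ.n≤1+n j) p))) (s≗t r)

  zhat-prefix : ∀ {m m′} (σ : Fin m → Fin D) (τ : Fin m′ → Fin D) j (p : j ≤ m) (q : j ≤ m′) (j≤D : j ≤ D) →
                (∀ x → σ (inject≤ x p) ≡ τ (inject≤ x q)) → zhat v σ j p j≤D ≡ zhat v τ j q j≤D
  zhat-prefix σ τ j p q j≤D σ≗τ = ≡.cong₂ (λ x y → x * y ⁻¹)
    (det-cong≡ j (λ r c → ≡.cong (λ x → xhat v x (inject≤ c j≤D)) (σ≗τ r)))
    (det-cong≡ j (Yhat-cong j j≤D σ≗τ))

  zhat-index : ∀ {m} (σ : Fin m → Fin D) {j j′} → j ≡ j′ →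
               (p : j ≤ m) (q : j ≤ D) (p′ : j′ ≤ m) (q′ : j′ ≤ D) → zhat v σ j p q ≡ zhat v σ j′ p′ q′
  zhat-index σ refl p q p′ q′ = ≡.cong₂ (zhat v σ _) (ℕₚ.≤-irrelevant p p′) (ℕₚ.≤-irrelevant q q′)

  prodZ-prefix : ∀ {m m′} (σ : Fin m → Fin D) (τ : Fin m′ → Fin D) i (p : i ≤ m) (q : i ≤ m′) (i≤D : i ≤ D) →
                 (∀ x → σ (inject≤ x p) ≡ τ (inject≤ x q)) → prodZ v σ i p i≤D ≈ prodZ v τ i q i≤D
  prodZ-prefix σ τ i p q i≤D σ≗τ = ∏-cong i λ t → reflexive (zhat-prefix σ τ (suc (toℕ t))
    (ℕₚ.≤-trans (Finₚ.toℕ<n t) p) (ℕₚ.≤-trans (Finₚ.toℕ<n t) q) (ℕₚ.≤-trans (Finₚ.toℕ<n t) i≤D) λ x →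
    ≡.trans (≡.cong σ (≡.sym (Finₚ.inject≤-trans x (Finₚ.toℕ<n t) p)))
      (≡.trans (σ≗τ (inject≤ x (Finₚ.toℕ<n t))) (≡.cong τ (Finₚ.inject≤-trans x (Finₚ.toℕ<n t) q))))

  prodZ-snoc : ∀ {k} (f : Fin k → Fin D) a (p : suc k ≤ D) →
    prodZ v (snoc f a) (suc k) ≤-refl p ≈
    prodZ v f k ≤-refl (ℕₚ.≤-trans (ℕₚ.n≤1+n k) p) * zhat v (snoc f a) (suc k) ≤-refl p
  prodZ-snoc {k} f a p = begin
    prodZ v σ (suc k) ≤-refl p
      ≈⟨ ∏-init-last k Z ⟩
    ∏ k (Z ∘ inject₁) * Z (fromℕ k)
      ≈⟨ *-cong (∏-cong k (λ t → reflexive (zhat-index σ (≡.cong suc (Finₚ.toℕ-inject₁ t))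
                   (ℕₚ.≤-trans (Finₚ.toℕ<n (inject₁ t)) ≤-refl) (ℕₚ.≤-trans (Finₚ.toℕ<n (inject₁ t)) p)
                   (ℕₚ.≤-trans (Finₚ.toℕ<n t) (ℕₚ.n≤1+n k)) (ℕₚ.≤-trans (Finₚ.toℕ<n t) p′))))
                (reflexive (zhat-index σ (≡.cong suc (Finₚ.toℕ-fromℕ k))
                   (ℕₚ.≤-trans (Finₚ.toℕ<n (fromℕ k)) ≤-refl) (ℕₚ.≤-trans (Finₚ.toℕ<n (fromℕ k)) p) ≤-refl p)) ⟩
    prodZ v σ k (ℕₚ.n≤1+n k) p′ * zhat v σ (suc k) ≤-refl p
      ≈⟨ *-cong (prodZ-prefix σ f k (ℕₚ.n≤1+n k) ≤-refl p′ init) ≈-refl ⟩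
    prodZ v f k ≤-refl p′ * zhat v σ (suc k) ≤-refl p ∎
    where
    σ = snoc f a
    p′ = ℕₚ.≤-trans (ℕₚ.n≤1+n k) p
    Z : Fin (suc k) → Carrier
    Z t = zhat v σ (suc (toℕ t)) (ℕₚ.≤-trans (Finₚ.toℕ<n t) ≤-refl) (ℕₚ.≤-trans (Finₚ.toℕ<n t) p)
    init : ∀ x → σ (inject≤ x (ℕₚ.n≤1+n k)) ≡ f (inject≤ x ≤-refl)
    init x = ≡.trans (≡.cong σ (Finₚ.toℕ-injective (≡.trans (Finₚ.toℕ-inject≤ x _) (≡.sym (Finₚ.toℕ-inject₁ x)))))
               (≡.trans (snoc-inject₁ f a x) (≡.cong f (≡.sym (Finₚ.inject≤-refl x _))))

  zhat-full : ∀ {k} (σ : Fin k → Fin D) (p : k ≤ D) →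
              zhat v σ k ≤-refl p ≡ det k (Xhat v k p σ) * det k (Yhat v k p σ) ⁻¹
  zhat-full {k} σ p = ≡.cong₂ (λ x y → x * y ⁻¹)
    (det-cong≡ k (λ r c → ≡.cong (λ x → xhat v x (inject≤ c p)) (σ-inject≤ r)))
    (det-cong≡ k (Yhat-cong k p σ-inject≤))
    where
    σ-inject≤ : ∀ r → σ (inject≤ r ≤-refl) ≡ σ r
    σ-inject≤ r = ≡.cong σ (Finₚ.inject≤-refl r _)

  Yrow : ∀ {k} → suc k ≤ D → Fin D → Fin (suc k) → Carrier
  Yrow p x zero    = 1#
  Yrow {k} p x (suc c) = xhat v x (inject≤ c (ℕₚ.≤-trans (ℕₚ.n≤1+n k) p))

  det-Yhat-rows : ∀ {k} (p : suc k ≤ D) (s : Fin (suc k) → Fin D) →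
                  det (suc k) (Yhat v (suc k) p s) ≡ det (suc k) (Yrow p ∘ s)
  det-Yhat-rows {k} p s = det-cong≡ (suc k) rows
    where
    rows : ∀ r c → Yhat v (suc k) p s r c ≡ Yrow p (s r) c
    rows r zero    = refl
    rows r (suc c) = refl

  zhat-↭ : ∀ {k} (p : suc k ≤ D) {σ s : Fin (suc k) → Fin D} → σ ↭ s →
           ¬ det (suc k) (Yhat v (suc k) p s) ≈ 0# →
           zhat v σ (suc k) ≤-refl p ≈ det (suc k) (Xhat v (suc k) p s) * det (suc k) (Yhat v (suc k) p s) ⁻¹
  zhat-↭ {k} p {σ} {s} σ↭s Y≉0 = trans (reflexive (zhat-full σ p)) (ratio-scale εε≈1 Y≉0
    (det-↭ (suc k) (λ x j → xhat v x (inject≤ j p)) σ↭s)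
    (begin
      det (suc k) (Yhat v (suc k) p σ)  ≡⟨ det-Yhat-rows p σ ⟩
      det (suc k) (Yrow p ∘ σ)          ≈⟨ det-↭ (suc k) (Yrow p) σ↭s ⟩
      ε * det (suc k) (Yrow p ∘ s)      ≡⟨ ≡.cong (ε *_) (det-Yhat-rows p s) ⟨
      ε * det (suc k) (Yhat v (suc k) p s) ∎))
    where
    ε = sign′ σ * sign′ s
    εε≈1 : ε * ε ≈ 1#
    εε≈1 = trans (interchange _ _ _ _) (trans (*-cong (negOnePow-square (inversions′ σ))
                                                      (negOnePow-square (inversions′ s))) (*-identityˡ 1#))

  det-Yhat-expand-col₀ : ∀ {k} (p : suc k ≤ D) (s : Fin (suc k) → Fin D) →
    det (suc k) (Yhat v (suc k) p s) ≈
    ∑ (suc k) (λ r → negOnePow (toℕ r) * det k (Xhat v k (ℕₚ.≤-trans (ℕₚ.n≤1+n k) p) (removeAt s r)))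
  det-Yhat-expand-col₀ {k} p s = trans (det-expand-col₀ k (Yhat v (suc k) p s))
    (∑-cong (suc k) (λ r → *-cong (≈-refl {negOnePow (toℕ r)})
      (*-identityˡ (det k (Xhat v k (ℕₚ.≤-trans (ℕₚ.n≤1+n k) p) (removeAt s r))))))

  -- If det Ŷ(s) vanished, its last-column cofactors would be the
  -- coefficients of an affine dependence among the vertices indexed by
  -- s; the first of them is ± det Ŷ(s ∘ suc), which is nonzero by induction.
  det-Yhat≉0 : GeneralPosition D v → ∀ k (p : suc k ≤ D) {s : Fin (suc k) → Fin D} → Injective≡ s →
               ¬ det (suc k) (Yhat v (suc k) p s) ≈ 0#
  det-Yhat≉0 gp zero    p s-inj det≈0 =
    0≉1 (trans (sym det≈0) (trans (+-identityʳ _) (trans (*-identityˡ _) (*-identityˡ _))))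
  det-Yhat≉0 gp (suc k) p {s} s-inj det≈0 =
    det-Yhat≉0 gp k p′ (removeAt-injective zero s-inj) (negOnePow-cancel (suc k) (begin
      negOnePow (suc k) * det (suc k) (Yhat v (suc k) p′ (s ∘ suc))
        ≈⟨ *-cong ≈-refl (trans (reflexive (det-cong≡ (suc k) first-minor)) (sym (*-identityˡ _))) ⟩
      λc zero
        ≈⟨ gp (suc k) p (inject₁ ∘ s) (λ a b → s-inj ∘ Finₚ.inject₁-injective) λc ∑λ≈0 ∑λv≈0 zero ⟩
      0# ∎))
    where
    p′ = ℕₚ.≤-trans (ℕₚ.n≤1+n (suc k)) p
    Y = Yhat v (suc (suc k)) p s
    λc : Fin (suc (suc k)) → Carrier
    λc = cofactorₗ (suc k) Y
    ∑λY≈0 : ∀ c → ∑ (suc (suc k)) (λ r → λc r * Y r c) ≈ 0#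
    ∑λY≈0 = cofactorsₗ-annihilate (suc k) Y det≈0
    ∑λ≈0 : ∑ (suc (suc k)) λc ≈ 0#
    ∑λ≈0 = trans (∑-cong (suc (suc k)) (λ r → sym (*-identityʳ (λc r)))) (∑λY≈0 zero)
    ∑λv≈0 : ∀ j → ∑ (suc (suc k)) (λ r → λc r * v (inject₁ (s r)) (inject≤ j (ℕₚ.<⇒≤ p))) ≈ 0#
    ∑λv≈0 j = begin
      ∑ (suc (suc k)) (λ r → λc r * x r)
        ≈⟨ ∑-cong (suc (suc k)) (λ r → trans (*-cong ≈-refl (x≈x-y+y r)) (distribˡ (λc r) _ y)) ⟩
      ∑ (suc (suc k)) (λ r → λc r * Y r (suc j) + λc r * y)
        ≈⟨ ∑-distrib-+ (suc (suc k)) (λ r → λc r * Y r (suc j)) (λ r → λc r * y) ⟩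
      ∑ (suc (suc k)) (λ r → λc r * Y r (suc j)) + ∑ (suc (suc k)) (λ r → λc r * y)
        ≈⟨ +-cong (∑λY≈0 (suc j)) (∑-cong (suc (suc k)) (λ r → *-comm (λc r) y)) ⟩
      0# + ∑ (suc (suc k)) (λ r → y * λc r)
        ≈⟨ trans (+-identityˡ _) (sym (*-distribˡ-∑ (suc (suc k)) y λc)) ⟩
      y * ∑ (suc (suc k)) λc
        ≈⟨ trans (*-cong ≈-refl ∑λ≈0) (zeroʳ y) ⟩
      0# ∎
      where
      J = inject≤ j (ℕₚ.<⇒≤ p)
      x : Fin (suc (suc k)) → Carrier
      x r = v (inject₁ (s r)) J
      y = v (fromℕ D) J
      x≈x-y+y : ∀ r → x r ≈ (x r - y) + y
      x≈x-y+y r = sym (trans (+-assoc _ _ _) (trans (+-cong ≈-refl (-‿inverseˡ y)) (+-identityʳ _)))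
    first-minor : ∀ a b → Yhat v (suc k) p′ (s ∘ suc) a b ≡ Y (suc a) (punchIn (fromℕ (suc k)) b)
    first-minor a zero    = refl
    first-minor a (suc b) = ≡.cong (xhat v (s (suc a))) (Finₚ.toℕ-injective (≡.trans (Finₚ.toℕ-inject≤ b _)
      (≡.sym (≡.trans (Finₚ.toℕ-inject≤ (punchIn (fromℕ k) b) _)
        (≡.trans (≡.cong toℕ (punchIn-fromℕ b)) (Finₚ.toℕ-inject₁ b))))))

  orderingSum : ∀ k → k ≤ D → (Fin k → Fin D) → Carrier
  orderingSum k p s =
    ∑L (allFuns k D) (λ σ → if isOrderingOfB σ s then sign′ σ * prodZ v σ k ≤-refl p else 0#)

  module _ (gp : GeneralPosition D v) {k} (p : suc k ≤ D) {s : Fin (suc k) → Fin D} (s-inj : Injective≡ s) where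

    private
      p′ = ℕₚ.≤-trans (ℕₚ.n≤1+n k) p
      R = det (suc k) (Xhat v (suc k) p s) * det (suc k) (Yhat v (suc k) p s) ⁻¹

    -- the factor picked up by an ordering of s ending in s r
    lastFactor : Fin (suc k) → Carrier
    lastFactor r = (negOnePow k * negOnePow (countBelow (s r) (removeAt s r))) * R

    snoc-summand : ∀ r (f : Fin k → Fin D) → f ↭ removeAt s r →
      sign′ (snoc f (s r)) * prodZ v (snoc f (s r)) (suc k) ≤-refl p ≈ lastFactor r * (sign′ f * prodZ v f k ≤-refl p′)
    snoc-summand r f f↭ = begin
      sign′ σ * prodZ v σ (suc k) ≤-refl p
        ≈⟨ *-cong (sign′-snoc f (s r) (injectiveˡ σ↭s)) (prodZ-snoc f (s r) p) ⟩
      (negOnePow k * (negOnePow (countBelow (s r) f) * sign′ f)) * (prodZ v f k ≤-refl p′ * zhat v σ (suc k) ≤-refl p)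
        ≈⟨ *-cong (*-cong ≈-refl (*-cong (reflexive (≡.cong negOnePow (countBelow-↭ (s r) f↭))) ≈-refl))
                  (*-cong ≈-refl (zhat-↭ p σ↭s (det-Yhat≉0 gp k p s-inj))) ⟩
      (negOnePow k * (negOnePow (countBelow (s r) (removeAt s r)) * sign′ f)) * (prodZ v f k ≤-refl p′ * R)
        ≈⟨ solve 5 (λ e b g z x → (e :* (b :* g)) :* (z :* x) := ((e :* b) :* x) :* (g :* z)) ≈-refl
             (negOnePow k) (negOnePow (countBelow (s r) (removeAt s r))) (sign′ f) (prodZ v f k ≤-refl p′) R ⟩
      lastFactor r * (sign′ f * prodZ v f k ≤-refl p′) ∎
      where
      σ = snoc f (s r)
      σ↭s : σ ↭ s
      σ↭s = Equivalence.from (snoc-↭ r s-inj) f↭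

    orderingSum-lastEntry : orderingSum (suc k) p s ≈ ∑ (suc k) (λ r → lastFactor r * orderingSum k p′ (removeAt s r))
    orderingSum-lastEntry = begin
      orderingSum (suc k) p s
        ≈⟨ ∑L-allFuns-snoc k D G ⟩
      ∑ D (λ a → ∑L (allFuns k D) (λ f → G (snoc f a)))
        ≈⟨ ∑-image (suc k) D s-inj _ (λ a a∉s → ∑L-zero (allFuns k D) λ f →
             if-false (snoc-≁ a∉s f ∘ Equivalence.to (T-isOrderingOfB s-inj))) ⟩
      ∑ (suc k) (λ r → ∑L (allFuns k D) (λ f → G (snoc f (s r))))
        ≈⟨ ∑-cong (suc k) ending-in ⟩
      ∑ (suc k) (λ r → lastFactor r * orderingSum k p′ (removeAt s r)) ∎
      where
      G : (Fin (suc k) → Fin D) → Carrier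
      G σ = if isOrderingOfB σ s then sign′ σ * prodZ v σ (suc k) ≤-refl p else 0#
      ordering⇔ : ∀ r f → T (isOrderingOfB (snoc f (s r)) s) ⇔ T (isOrderingOfB f (removeAt s r))
      ordering⇔ r f = ⇔-sym (T-isOrderingOfB (removeAt-injective r s-inj)) ⇔-∘
                      (snoc-↭ r s-inj ⇔-∘ T-isOrderingOfB s-inj)
      ending-in : ∀ r → ∑L (allFuns k D) (λ f → G (snoc f (s r))) ≈ lastFactor r * orderingSum k p′ (removeAt s r)
      ending-in r = begin
        ∑L (allFuns k D) (λ f → G (snoc f (s r)))
          ≈⟨ ∑L-cong (allFuns k D) (λ f → if-cong (ordering⇔ r f)
               (snoc-summand r f ∘ Equivalence.to (snoc-↭ r s-inj) ∘ Equivalence.to (T-isOrderingOfB s-inj))) ⟩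
        ∑L (allFuns k D) (λ f → if isOrderingOfB f (removeAt s r)
                                 then lastFactor r * (sign′ f * prodZ v f k ≤-refl p′) else 0#)
          ≈⟨ ∑L-cong (allFuns k D) (λ f → *-if (isOrderingOfB f (removeAt s r)) (lastFactor r) _) ⟨
        ∑L (allFuns k D) (λ f → lastFactor r * (if isOrderingOfB f (removeAt s r)
                                                 then sign′ f * prodZ v f k ≤-refl p′ else 0#))
          ≈⟨ *-distribˡ-∑L (allFuns k D) (lastFactor r) _ ⟨
        lastFactor r * orderingSum k p′ (removeAt s r) ∎

  orderingSum-Xhat : GeneralPosition D v → ∀ k (p : k ≤ D) {s : Fin k → Fin D} → Injective≡ s →
    orderingSum k p s ≈ negOnePow ((k *ℕ (k ∸ 1)) / 2) * (sign′ s * det k (Xhat v k p s))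
  orderingSum-Xhat gp zero    p s-inj = trans (+-identityʳ _) (sym (*-identityˡ _))
  orderingSum-Xhat gp (suc k) p {s} s-inj = begin
    orderingSum (suc k) p s
      ≈⟨ orderingSum-lastEntry gp p s-inj ⟩
    ∑ (suc k) (λ r → lastFactor gp p s-inj r * orderingSum k p′ (removeAt s r))
      ≈⟨ ∑-cong (suc k) (λ r → *-cong (≈-refl {lastFactor gp p s-inj r})
                                      (orderingSum-Xhat gp k p′ (removeAt-injective r s-inj))) ⟩
    ∑ (suc k) (λ r → lastFactor gp p s-inj r * (τ * (sign′ (removeAt s r) * X r)))
      ≈⟨ ∑-cong (suc k) regroup ⟩
    ∑ (suc k) (λ r → W * (negOnePow (toℕ r) * X r))
      ≈⟨ *-distribˡ-∑ (suc k) W (λ r → negOnePow (toℕ r) * X r) ⟨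
    W * ∑ (suc k) (λ r → negOnePow (toℕ r) * X r)
      ≈⟨ *-cong ≈-refl (det-Yhat-expand-col₀ p s) ⟨
    W * DY
      ≈⟨ solve 6 (λ e x i τ g y → (((e :* (x :* i)) :* τ) :* g) :* y := ((τ :* e) :* (g :* x)) :* (y :* i)) ≈-refl
           (negOnePow k) DX (DY ⁻¹) τ (sign′ s) DY ⟩
    ((τ * negOnePow k) * (sign′ s * DX)) * (DY * DY ⁻¹)
      ≈⟨ trans (*-cong ≈-refl (⁻¹-inverse DY (det-Yhat≉0 gp k p s-inj))) (*-identityʳ _) ⟩
    (τ * negOnePow k) * (sign′ s * DX)
      ≈⟨ *-cong (trans (sym (negOnePow-+ ((k *ℕ (k ∸ 1)) / 2) k))
                       (reflexive (≡.cong negOnePow (≡.sym (triangular-suc k))))) ≈-refl ⟩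
    negOnePow ((suc k *ℕ k) / 2) * (sign′ s * DX) ∎
    where
    p′ = ℕₚ.≤-trans (ℕₚ.n≤1+n k) p
    τ = negOnePow ((k *ℕ (k ∸ 1)) / 2)
    DX = det (suc k) (Xhat v (suc k) p s)
    DY = det (suc k) (Yhat v (suc k) p s)
    X : Fin (suc k) → Carrier
    X r = det k (Xhat v k p′ (removeAt s r))
    W = ((negOnePow k * (DX * DY ⁻¹)) * τ) * sign′ s
    regroup : ∀ r → lastFactor gp p s-inj r * (τ * (sign′ (removeAt s r) * X r)) ≈ W * (negOnePow (toℕ r) * X r)
    regroup r = begin
      ((negOnePow k * b) * (DX * DY ⁻¹)) * (τ * (sign′ (removeAt s r) * X r))
        ≈⟨ solve 6 (λ e b q τ g x → ((e :* b) :* q) :* (τ :* (g :* x)) := ((e :* q) :* τ) :* ((b :* g) :* x))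
             ≈-refl (negOnePow k) b (DX * DY ⁻¹) τ (sign′ (removeAt s r)) (X r) ⟩
      ((negOnePow k * (DX * DY ⁻¹)) * τ) * ((b * sign′ (removeAt s r)) * X r)
        ≈⟨ *-cong ≈-refl (*-cong (sign′-moveToFront s-inj r) ≈-refl) ⟨
      ((negOnePow k * (DX * DY ⁻¹)) * τ) * ((sign′ s * negOnePow (toℕ r)) * X r)
        ≈⟨ trans (*-assoc _ _ _) (*-cong ≈-refl (sym (*-assoc _ _ _))) ⟨
      W * (negOnePow (toℕ r) * X r) ∎
      where b = negOnePow (countBelow (s r) (removeAt s r))

module Concatenation {c ℓ} (F : Field c ℓ) {i e : ℕ} (v : FieldDefs.Vertices F (i +ℕ e)) (δ : Fin e → Fin (i +ℕ e)) where

  open Field F hiding (zero) renaming (refl to ≈-refl)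
  open FieldDefs F
  open LinearAlgebra F
  open Simplex F v
  open import Relation.Binary.Reasoning.Setoid setoid

  i≤i+e : i ≤ i +ℕ e
  i≤i+e = m≤m+n i e

  -- the sign contributed by δ and by the entries of f before it
  tailSign : (Fin i → Fin (i +ℕ e)) → Carrier
  tailSign f = negOnePow (crossings f δ +ℕ inversions′ δ)

  sign′-concatSeq : ∀ f → sign′ (concatSeq f δ) ≈ sign′ f * tailSign f
  sign′-concatSeq f = trans (reflexive (≡.cong negOnePow (inversions′-concatSeq f δ))) (negOnePow-+ (inversions′ f) _)

  prodZ-concatSeq : ∀ f → prodZ v (concatSeq f δ) i i≤i+e i≤i+e ≈ prodZ v f i ≤-refl i≤i+e
  prodZ-concatSeq f = prodZ-prefix (concatSeq f δ) f i i≤i+e ≤-refl i≤i+e λ x →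
    ≡.trans (≡.cong (concatSeq f δ) (Finₚ.toℕ-injective
              (≡.trans (Finₚ.toℕ-inject≤ x i≤i+e) (≡.sym (Finₚ.toℕ-↑ˡ x e)))))
      (≡.trans (concatSeq-↑ˡ f δ x) (≡.cong f (≡.sym (Finₚ.inject≤-refl x _))))

  concatSeq-summand : ∀ {f γ} → f ↭ γ →
    sign′ (concatSeq f δ) * prodZ v (concatSeq f δ) i i≤i+e i≤i+e ≈ tailSign γ * (sign′ f * prodZ v f i ≤-refl i≤i+e)
  concatSeq-summand {f} {γ} f↭γ = begin
    sign′ (concatSeq f δ) * prodZ v (concatSeq f δ) i i≤i+e i≤i+e
      ≈⟨ *-cong (sign′-concatSeq f) (prodZ-concatSeq f) ⟩
    (sign′ f * tailSign f) * prodZ v f i ≤-refl i≤i+e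
      ≡⟨ ≡.cong (λ n → (sign′ f * negOnePow (n +ℕ inversions′ δ)) * prodZ v f i ≤-refl i≤i+e)
                (crossings-↭ δ f↭γ) ⟩
    (sign′ f * tailSign γ) * prodZ v f i ≤-refl i≤i+e
      ≈⟨ trans (*-cong (*-comm _ _) ≈-refl) (*-assoc _ _ _) ⟩
    tailSign γ * (sign′ f * prodZ v f i ≤-refl i≤i+e) ∎

  concatSeq-injectiveˡ : ∀ {γ : Fin i → Fin (i +ℕ e)} →
                         (∀ a b → concatSeq γ δ a ≡ concatSeq γ δ b → a ≡ b) → Injective≡ γ
  concatSeq-injectiveˡ {γ} inj {a} {b} γa≡γb = Finₚ.↑ˡ-injective e a b (inj (a ↑ˡ e) (b ↑ˡ e)
    (≡.trans (concatSeq-↑ˡ γ δ a) (≡.trans γa≡γb (≡.sym (concatSeq-↑ˡ γ δ b)))))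

module _ {c ℓ} (F : Field c ℓ) where

  open Field F hiding (zero) renaming (refl to ≈-refl)
  open FieldDefs F
  open LinearAlgebra F
  open Simplex F using (orderingSum; orderingSum-Xhat)
  open import Relation.Binary.Reasoning.Setoid setoid
  open import Algebra.Solver.Ring.NaturalCoefficients.Default commutativeSemiring
    using (solve; _:*_; _:=_)

  orderingSum-concatSeq : ∀ i e (v : Vertices (i +ℕ e)) → GeneralPosition (i +ℕ e) v →
    (γ : Fin i → Fin (i +ℕ e)) (δ : Fin e → Fin (i +ℕ e)) →
    (∀ a b → concatSeq γ δ a ≡ concatSeq γ δ b → a ≡ b) →
    ∑L (allFuns i (i +ℕ e))
      (λ γ′ → if isOrderingOfB γ′ γ
              then sign (concatSeq γ′ δ) * prodZ v (concatSeq γ′ δ) i (m≤m+n i e) (m≤m+n i e)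
              else 0#)
    ≈ negOnePow ((i *ℕ (i ∸ 1)) / 2) * (sign (concatSeq γ δ) * det i (Xhat v i (m≤m+n i e) γ))
  orderingSum-concatSeq i e v gp γ δ concat-inj = begin
    ∑L (allFuns i (i +ℕ e)) (λ γ′ → if isOrderingOfB γ′ γ
                                     then sign (concatSeq γ′ δ) * prodZ v (concatSeq γ′ δ) i i≤i+e i≤i+e else 0#)
      ≈⟨ ∑L-cong (allFuns i (i +ℕ e)) (λ γ′ → trans
           (if-cong (⇔-id _) (concatSeq-summand ∘ Equivalence.to (T-isOrderingOfB γ-inj)))
           (sym (*-if (isOrderingOfB γ′ γ) (tailSign γ) _))) ⟩
    ∑L (allFuns i (i +ℕ e)) (λ γ′ → tailSign γ * (if isOrderingOfB γ′ γ
                                                    then sign′ γ′ * prodZ v γ′ i ≤-refl i≤i+e else 0#))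
      ≈⟨ *-distribˡ-∑L (allFuns i (i +ℕ e)) (tailSign γ) _ ⟨
    tailSign γ * orderingSum v i i≤i+e γ
      ≈⟨ *-cong ≈-refl (orderingSum-Xhat v gp i i≤i+e γ-inj) ⟩
    tailSign γ * (τ * (sign′ γ * det i (Xhat v i i≤i+e γ)))
      ≈⟨ solve 4 (λ t τ g x → t :* (τ :* (g :* x)) := τ :* ((g :* t) :* x)) ≈-refl (tailSign γ) τ (sign′ γ) _ ⟩
    τ * ((sign′ γ * tailSign γ) * det i (Xhat v i i≤i+e γ))
      ≈⟨ *-cong ≈-refl (*-cong (sign′-concatSeq γ) ≈-refl) ⟨
    τ * (sign (concatSeq γ δ) * det i (Xhat v i i≤i+e γ)) ∎
    where
    open Concatenation F v δ
    γ-inj = concatSeq-injectiveˡ concat-inj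
    τ = negOnePow ((i *ℕ (i ∸ 1)) / 2)

  permutationSum : ∀ d (v : Vertices d) → GeneralPosition d v →
    ∑L (allFuns d d) (λ σ → if isPermB σ then sign σ * prodZ v σ d ≤-refl ≤-refl else 0#)
    ≈ negOnePow ((d *ℕ (d ∸ 1)) / 2) * det d (Xhat v d ≤-refl (λ r → r))
  permutationSum d v gp = begin
    ∑L (allFuns d d) (λ σ → if isPermB σ then sign σ * prodZ v σ d ≤-refl ≤-refl else 0#)
      ≈⟨ ∑L-cong (allFuns d d) (λ σ → reflexive (≡.cong (λ b → if b then sign σ * prodZ v σ d ≤-refl ≤-refl else 0#)
                                                          (isPermB≡isOrderingOfB-id σ))) ⟩
    orderingSum v d ≤-refl (λ r → r)
      ≈⟨ orderingSum-Xhat v gp d ≤-refl (λ eq → eq) ⟩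
    τ * (sign′ {d} (λ r → r) * det d (Xhat v d ≤-refl (λ r → r)))
      ≈⟨ *-cong ≈-refl (trans (*-cong (reflexive (≡.cong negOnePow (inversions′-id d))) ≈-refl) (*-identityˡ _)) ⟩
    τ * det d (Xhat v d ≤-refl (λ r → r)) ∎
    where τ = negOnePow ((d *ℕ (d ∸ 1)) / 2)

lemma7p2 : ∀ {c ℓ} (F : Field c ℓ) →
    let open Field F in
    let open FieldDefs F in
    ((i e : ℕ) → 1 ≤ i →
      (v : Vertices (i +ℕ e)) → GeneralPosition (i +ℕ e) v →
      (γ : Fin i → Fin (i +ℕ e)) (δ : Fin e → Fin (i +ℕ e)) →
      (∀ a b → concatSeq γ δ a ≡ concatSeq γ δ b → a ≡ b) →
      ∑L (allFuns i (i +ℕ e))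
        (λ γ′ → if isOrderingOfB γ′ γ
                then sign (concatSeq γ′ δ) * prodZ v (concatSeq γ′ δ) i (m≤m+n i e) (m≤m+n i e)
                else 0#)
      ≈ negOnePow ((i *ℕ (i ∸ 1)) / 2) * (sign (concatSeq γ δ) * det i (Xhat v i (m≤m+n i e) γ)))
    ×
    ((d : ℕ) → 1 ≤ d →
      (v : Vertices d) → GeneralPosition d v →
      ∑L (allFuns d d)
        (λ σ → if isPermB σ then sign σ * prodZ v σ d ≤-refl ≤-refl else 0#)
      ≈ negOnePow ((d *ℕ (d ∸ 1)) / 2) * det d (Xhat v d ≤-refl (λ r → r)))
lemma7p2 F = (λ i e _ → orderingSum-concatSeq F i e) , (λ d _ → permutationSum F d)
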